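{- Let $A$ be the vertex–arc incidence matrix of $G_d$. The minimum, over all term orders, of the cardinality of the reduced Gröbner basis of $I_A$ is $\binom d2-(d-1)$; it is attained by the reduced Gröbner basis $\{x_{i,j}-x_{i,i+1}x_{i+1,i+2}\cdots x_{j-1,j}: i<j-1\}$ with respect to the pure lexicographic order induced by $x_{i,j}\succ x_{k,l}$ iff $i<k$, or $i=k$ and $j>l$.
   Context: $G_d$ has vertices $1,\dots,d$ and arcs $(i,j)$, $1\le i<j\le d$, directed from $i$ to $j$; $n=\binom d2$. Its vertex–arc incidence matrix $A$ has in the column of arc $(i,j)$ entry $1$ in row $i$, $-1$ in row $j$, $0$ elsewhere. $I_A=\langle\mathbf{x}^{\mathbf{u}}-\mathbf{x}^{\mathbf{v}}:A\mathbf{u}=A\mathbf{v},\ \mathbf{u},\mathbf{v}\in\mathbb{N}^n\rangle\subseteq k[x_{i,j}:1\le i<j\le d]$. -}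

module Defs where

open import Level using (Level; _⊔_)
open import Algebra.Bundles using (CommutativeRing)
open import Data.Nat as ℕ using (ℕ; zero; suc; _≤_; _<_; _∸_)
open import Data.Fin as Fin using (Fin; toℕ)
open import Data.Fin.Properties using () renaming (_≟_ to _≟ᶠ_)
open import Data.Integer as ℤ using (ℤ)
open import Data.List as List using (List; []; _∷_; _++_; length; allFin; cartesianProduct; filter; concatMap)
open import Data.List.Relation.Unary.All using (All)
open import Data.Vec as Vec using (Vec)
open import Data.Vec.Properties using (≡-dec)
open import Data.Product using (Σ; ∃; ∃-syntax; _×_; _,_; proj₁; proj₂)
open import Data.Sum using (_⊎_)
open import Relation.Nullary using (¬_; yes; no; Dec)
open import Relation.Unary using (Pred)
open import Relation.Binary using (Rel; IsStrictTotalOrder)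
open import Relation.Binary.PropositionalEquality using (_≡_; _≢_)

record IsField {c ℓ} (R : CommutativeRing c ℓ) : Set (c ⊔ ℓ) where
  open CommutativeRing R
  field
    0≉1     : ¬ (0# ≈ 1#)
    inverse : ∀ x → ¬ (x ≈ 0#) → ∃[ y ] (x * y ≈ 1#)

Mon : ℕ → Set
Mon n = Vec ℕ n

_+ᵐ_ : ∀ {n} → Mon n → Mon n → Mon n
_+ᵐ_ = Vec.zipWith ℕ._+_

0ᵐ : ∀ {n} → Mon n
0ᵐ = Vec.replicate _ 0

_∣ᵐ_ : ∀ {n} → Mon n → Mon n → Set
a ∣ᵐ b = ∀ k → Vec.lookup a k ≤ Vec.lookup b k

record IsTermOrder {n} (_≺_ : Rel (Mon n) Level.zero) : Set where
  field
    isStrictTotalOrder : IsStrictTotalOrder _≡_ _≺_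
    multiplicative     : ∀ a b c → a ≺ b → (a +ᵐ c) ≺ (b +ᵐ c)
    one-least          : ∀ a → a ≢ 0ᵐ → 0ᵐ ≺ a

-- Polynomials over a commutative ring R in n variables, represented as
-- finite formal sums  Σ cᵢ x^{aᵢ}  (lists of terms); equality is equality of
-- all coefficients.

module Poly {c ℓ} (R : CommutativeRing c ℓ) (n : ℕ) where
  open CommutativeRing R

  Polynomial : Set c
  Polynomial = List (Carrier × Mon n)

  coeff : Mon n → Polynomial → Carrier
  coeff m [] = 0#
  coeff m ((a , b) ∷ f) with ≡-dec ℕ._≟_ m b
  ... | yes _ = a + coeff m f
  ... | no  _ = coeff m f

  _≈ₚ_ : Polynomial → Polynomial → Set ℓ
  f ≈ₚ g = ∀ m → coeff m f ≈ coeff m g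

  0ₚ : Polynomial
  0ₚ = []

  _+ₚ_ : Polynomial → Polynomial → Polynomial
  _+ₚ_ = _++_

  _*ₚ_ : Polynomial → Polynomial → Polynomial
  f *ₚ g = concatMap (λ t → List.map (λ s → (proj₁ t * proj₁ s , proj₂ t +ᵐ proj₂ s)) g) f

  mono : Mon n → Polynomial
  mono a = (1# , a) ∷ []

  binomial : Mon n → Mon n → Polynomial
  binomial a b = (1# , a) ∷ (- 1# , b) ∷ []

  sumₚ : List Polynomial → Polynomial
  sumₚ = List.foldr _+ₚ_ 0ₚ

  ⟨_⟩ : ∀ {p} → Pred Polynomial p → Pred Polynomial (c ⊔ ℓ ⊔ p)
  ⟨ S ⟩ f = ∃[ hs ] (All (λ hg → S (proj₂ hg)) hs
                     × f ≈ₚ sumₚ (List.map (λ hg → proj₁ hg *ₚ proj₂ hg) hs))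

  LM : (_≺_ : Rel (Mon n) Level.zero) → Polynomial → Mon n → Set ℓ
  LM _≺_ f m = ¬ (coeff m f ≈ 0#)
             × (∀ m' → ¬ (coeff m' f ≈ 0#) → m' ≡ m ⊎ m' ≺ m)

  record IsReducedGB {p} (_≺_ : Rel (Mon n) Level.zero) (I : Pred Polynomial p)
                     (G : List Polynomial) : Set (c ⊔ ℓ ⊔ p) where
    field
      ⊆I      : All I G
      monic   : All (λ g → ∃[ m ] (LM _≺_ g m × coeff m g ≈ 1#)) G
      initial : ∀ f m → I f → LM _≺_ f m →
                ∃[ k ] ∃[ m' ] (LM _≺_ (List.lookup G k) m' × m' ∣ᵐ m)
      reduced : ∀ k k' → k ≢ k' → ∀ m → LM _≺_ (List.lookup G k) m →
                ∀ m' → ¬ (coeff m' (List.lookup G k') ≈ 0#) → ¬ (m ∣ᵐ m')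

-- The graph G_d: vertices Fin d (vertex i corresponds to i+1 in the paper),
-- arcs (i , j) with i < j, directed from i to j.

Arc : ℕ → Set
Arc d = Fin d × Fin d

arcs : (d : ℕ) → List (Arc d)
arcs d = filter (λ ij → proj₁ ij Fin.<? proj₂ ij) (cartesianProduct (allFin d) (allFin d))

nArcs : ℕ → ℕ
nArcs d = length (arcs d)

-- variable number k is x_{arc k}
arc : ∀ {d} → Fin (nArcs d) → Arc d
arc {d} = List.lookup (arcs d)

incidence : ∀ {d} → Fin d → Fin (nArcs d) → ℤ
incidence v k with v ≟ᶠ proj₁ (arc k) | v ≟ᶠ proj₂ (arc k)
... | yes _ | _     = ℤ.+ 1
... | no _  | yes _ = ℤ.- (ℤ.+ 1)
... | no _  | no _  = ℤ.+ 0

_·A_ : ∀ {d} → Fin d → Mon (nArcs d) → ℤ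
_·A_ {d} v u = List.foldr ℤ._+_ (ℤ.+ 0)
  (List.map (λ k → incidence v k ℤ.* ℤ.+ (Vec.lookup u k)) (allFin (nArcs d)))

module GraphIdeal {c ℓ} (R : CommutativeRing c ℓ) (d : ℕ) where
  open Poly R (nArcs d)

  BinGen : Pred Polynomial c
  BinGen f = ∃[ u ] ∃[ v ] ((∀ w → _·A_ {d} w u ≡ _·A_ {d} w v) × f ≡ binomial u v)

  I_A : Pred Polynomial (c ⊔ ℓ)
  I_A = ⟨ BinGen ⟩

  _≻var_ : Arc d → Arc d → Set
  (i , j) ≻var (k , l) = (toℕ i < toℕ k) ⊎ (i ≡ k × toℕ l < toℕ j)

  _≺lex_ : Rel (Mon (nArcs d)) Level.zero
  b ≺lex a = ∃[ k ] (Vec.lookup b k < Vec.lookup a k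
                    × (∀ k' → arc k' ≻var arc k → Vec.lookup a k' ≡ Vec.lookup b k'))

  varMon : Arc d → Mon (nArcs d)
  varMon ij = Vec.tabulate (λ k → indicator (arc k))
    where
    indicator : Arc d → ℕ
    indicator kl with proj₁ kl ≟ᶠ proj₁ ij | proj₂ kl ≟ᶠ proj₂ ij
    ... | yes _ | yes _ = 1
    ... | _     | _     = 0

  pathMon : Arc d → Mon (nArcs d)
  pathMon ij = Vec.tabulate (λ k → onPath (arc k))
    where
    onPath : Arc d → ℕ
    onPath ab with suc (toℕ (proj₁ ab)) ℕ.≟ toℕ (proj₂ ab)
                 | toℕ (proj₁ ij) ℕ.≤? toℕ (proj₁ ab)
                 | toℕ (proj₂ ab) ℕ.≤? toℕ (proj₂ ij)
    ... | yes _ | yes _ | yes _ = 1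
    ... | _     | _     | _     = 0

  pathGB : List Polynomial
  pathGB = List.map (λ ij → binomial (varMon ij) (pathMon ij))
    (filter (λ ij → suc (toℕ (proj₁ ij)) ℕ.<? toℕ (proj₂ ij)) (arcs d))

{-# OPTIONS --safe #-}

-- Summing the coefficients of a polynomial over one fibre {m' : A m' = A m} is a
-- linear functional that kills every multiple of a binomial x^u − x^v with Au = Av,
-- hence all of I_A.  So no element of I_A has as leading monomial the least monomial
-- of its fibre; in particular leading monomials are never 1.
--
-- Lower bound: choose a variable in the leading monomial of each element of a reduced
-- Gröbner basis G.  If |G| < C(d,2) − (d − 1), at least d arcs of G_d are unchosen,
-- and d arcs on d vertices carry a nonzero integer circulation c (contract an arc and
-- induct on d).  The binomial x^{c⁺} − x^{c⁻} lies in I_A, but its leading monomial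
-- involves unchosen variables only, so it is divisible by no leading monomial of G.
--
-- Upper bound: x_{i,j} − x_{i,i+1} ⋯ x_{j−1,j} lies in I_A with leading monomial x_{i,j}.
-- A monomial in no long variable x_{i,j} (j > i + 1) is the lex-least monomial of its
-- fibre, so the leading monomial of any element of I_A contains a long variable.

module Submission where

open import Defs
open import Algebra.Bundles using (CommutativeRing)
open import Data.Nat using (ℕ; suc; _≤_; _∸_)
open import Data.Nat.Combinatorics using (_C_)
open import Data.List using (List; length)
open import Data.Product using (_×_; _,_)
open import Relation.Binary using (Rel)
open import Relation.Binary.PropositionalEquality using (_≡_)
open import Relation.Nullary using (¬_)

module Lists where

  open import Data.Bool using (true; false)
  open import Data.Empty using (⊥-elim)
  open import Data.Fin as Fin using (Fin; zero; suc)
  open import Data.Fin.Properties using (pigeonhole; <⇒≢; toℕ-injective; toℕ-cast)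
  open import Data.List as List using (List; []; _∷_; _++_; length; map; filter; cartesianProduct)
  open import Data.List.Membership.Propositional using (_∈_)
  open import Data.List.Membership.Propositional.Properties using (∈-lookup)
  open import Data.List.Properties using (length-map)
  open import Data.List.Relation.Binary.Subset.Propositional using (_⊆_)
  open import Data.List.Relation.Unary.AllPairs using (_∷_)
  open import Data.List.Relation.Unary.Any as Any using (here; there)
  open import Data.List.Relation.Unary.Any.Properties using (lookup-index)
  open import Data.List.Relation.Unary.Unique.Propositional using (Unique)
  open import Data.List.Relation.Unary.Unique.Propositional.Properties using (Unique[x∷xs]⇒x∉xs)
  open import Data.Nat using (ℕ; _+_; _≤_)
  open import Data.Nat.ListAction using (sum)
  open import Data.Nat.Properties using (≮⇒≥)
  open import Data.Product using (∃-syntax; _×_; _,_)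
  open import Data.Sum using (_⊎_; inj₁; inj₂)
  open import Function using (_∘_)
  open import Level using (Level)
  open import Relation.Binary using (Rel; IsStrictTotalOrder; tri<; tri≈; tri>)
  open import Relation.Binary.PropositionalEquality using (_≡_; refl; sym; trans; cong; cong₂; subst; module ≡-Reasoning)
  open import Relation.Nullary using (¬_; yes; no; does; contradiction)
  open import Relation.Unary using (Pred; Decidable)

  private
    variable
      a b p q ℓ : Level
      A B : Set a

  lookup-injective : {xs : List A} → Unique xs → ∀ {i j} → List.lookup xs i ≡ List.lookup xs j → i ≡ j
  lookup-injective {xs = _ ∷ _}  _            {zero}  {zero}  _  = refl
  lookup-injective {xs = _ ∷ xs} u@(_ ∷ _)    {zero}  {suc j} eq =
    ⊥-elim (Unique[x∷xs]⇒x∉xs u (subst (_∈ xs) (sym eq) (∈-lookup j)))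
  lookup-injective {xs = _ ∷ xs} u@(_ ∷ _)    {suc i} {zero}  eq =
    ⊥-elim (Unique[x∷xs]⇒x∉xs u (subst (_∈ xs) eq (∈-lookup i)))
  lookup-injective (_ ∷ u) {suc i} {suc j} eq = cong suc (lookup-injective u eq)

  lookup-map : ∀ (f : A → B) xs i → List.lookup (map f xs) i ≡ f (List.lookup xs (Fin.cast (length-map f xs) i))
  lookup-map f (x ∷ xs) zero    = refl
  lookup-map f (x ∷ xs) (suc i) = lookup-map f xs i

  cast-injective : ∀ {m n} .(eq : m ≡ n) {i j : Fin m} → Fin.cast eq i ≡ Fin.cast eq j → i ≡ j
  cast-injective eq {i} {j} same = toℕ-injective (trans (sym (toℕ-cast eq i)) (trans (cong Fin.toℕ same) (toℕ-cast eq j)))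

  unique-⊆⇒length≤ : {xs ys : List A} → Unique xs → xs ⊆ ys → length xs ≤ length ys
  unique-⊆⇒length≤ {xs = xs} {ys} u xs⊆ys = ≮⇒≥ λ ys<xs →
    let i , j , i<j , same = pigeonhole ys<xs position
    in <⇒≢ i<j (lookup-injective u (trans (lookup-index (xs⊆ys (∈-lookup i)))
                                     (trans (cong (List.lookup ys) same)
                                            (sym (lookup-index (xs⊆ys (∈-lookup j)))))))
    where
    position : Fin (length xs) → Fin (length ys)
    position = Any.index ∘ xs⊆ys ∘ ∈-lookup

  ¬¬-∀∈ : {P : Pred A p} {xs : List A} →
          (∀ {x} → x ∈ xs → ¬ ¬ P x) → ¬ ¬ (∀ {x} → x ∈ xs → P x)
  ¬¬-∀∈ {xs = []}     _   ¬∀P = ¬∀P λ ()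
  ¬¬-∀∈ {xs = x ∷ xs} ¬¬P ¬∀P = ¬¬P (here refl) λ px →
    ¬¬-∀∈ (¬¬P ∘ there) λ ∀P → ¬∀P λ { (here refl) → px ; (there y∈) → ∀P y∈ }

  count : {P : Pred A p} → Decidable P → List A → ℕ
  count P? = length ∘ filter P?

  module _ {P : Pred A p} (P? : Decidable P) where

    count-++ : ∀ xs ys → count P? (xs ++ ys) ≡ count P? xs + count P? ys
    count-++ []       ys = refl
    count-++ (x ∷ xs) ys with does (P? x)
    ... | true  = cong suc (count-++ xs ys)
    ... | false = count-++ xs ys

    count-map : ∀ (f : B → A) xs → count P? (map f xs) ≡ count (P? ∘ f) xs
    count-map f []       = refl
    count-map f (x ∷ xs) with does (P? (f x))
    ... | true  = cong suc (count-map f xs)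
    ... | false = count-map f xs

    count-cong : {Q : Pred A q} (Q? : Decidable Q) → (∀ x → does (P? x) ≡ does (Q? x)) →
                 ∀ xs → count P? xs ≡ count Q? xs
    count-cong Q? same []       = refl
    count-cong Q? same (x ∷ xs) with does (P? x) | does (Q? x) | same x
    ... | true  | true  | refl = cong suc (count-cong Q? same xs)
    ... | false | false | refl = count-cong Q? same xs

    count-filter : {Q : Pred A q} (Q? : Decidable Q) → (∀ {x} → P x → Q x) → ∀ xs → count P? (filter Q? xs) ≡ count P? xs
    count-filter Q? P⊆Q []       = refl
    count-filter Q? P⊆Q (x ∷ xs) with Q? x
    ... | yes _ with does (P? x)
    ...   | true  = cong suc (count-filter Q? P⊆Q xs)
    ...   | false = count-filter Q? P⊆Q xs
    count-filter Q? P⊆Q (x ∷ xs) | no ¬qx with P? x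
    ...   | yes px = contradiction (P⊆Q px) ¬qx
    ...   | no  _  = count-filter Q? P⊆Q xs

  count-cartesianProduct : {P : Pred (A × B) p} (P? : Decidable P) → ∀ xs ys →
    count P? (cartesianProduct xs ys) ≡ sum (map (λ x → count (P? ∘ (x ,_)) ys) xs)
  count-cartesianProduct P? []       ys = refl
  count-cartesianProduct P? (x ∷ xs) ys = begin
    count P? (map (x ,_) ys ++ cartesianProduct xs ys)             ≡⟨ count-++ P? (map (x ,_) ys) _ ⟩
    count P? (map (x ,_) ys) + count P? (cartesianProduct xs ys)    ≡⟨ cong₂ _+_ (count-map P? (x ,_) ys)
                                                                                 (count-cartesianProduct P? xs ys) ⟩
    count (P? ∘ (x ,_)) ys + sum (map (λ x → count (P? ∘ (x ,_)) ys) xs) ∎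
    where open ≡-Reasoning

  module _ {_<_ : Rel A ℓ} (<-sto : IsStrictTotalOrder _≡_ _<_) {P : Pred A p} (P? : Decidable P) where

    open IsStrictTotalOrder <-sto using (compare; irrefl; asym) renaming (trans to <-trans)

    greatest? : ∀ xs → (∀ {y} → y ∈ xs → ¬ P y) ⊎ ∃[ x ] (P x × ∀ {y} → y ∈ xs → x < y → ¬ P y)
    greatest? []       = inj₁ λ ()
    greatest? (z ∷ xs) with greatest? xs | P? z
    ... | inj₁ none | no ¬pz = inj₁ λ { (here refl) → ¬pz ; (there y∈) → none y∈ }
    ... | inj₁ none | yes pz = inj₂ (z , pz , λ { (here refl) z<z → ⊥-elim (irrefl refl z<z)
                                                ; (there y∈) _ → none y∈ })
    ... | inj₂ (x , px , above) | no ¬pz = inj₂ (x , px , λ { (here refl) _ → ¬pz ; (there y∈) → above y∈ })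
    ... | inj₂ (x , px , above) | yes pz with compare x z
    ...   | tri< x<z _ _ = inj₂ (z , pz , λ { (here refl) z<z → ⊥-elim (irrefl refl z<z)
                                            ; (there y∈) z<y → above y∈ (<-trans x<z z<y) })
    ...   | tri≈ _ refl _ = inj₂ (x , px , λ { (here refl) x<x → ⊥-elim (irrefl refl x<x) ; (there y∈) → above y∈ })
    ...   | tri> _ _ z<x = inj₂ (x , px , λ { (here refl) x<z → ⊥-elim (asym z<x x<z) ; (there y∈) → above y∈ })


module ListSum {c ℓ} (R : CommutativeRing c ℓ) where

  open import Data.List using (List; []; _∷_; _++_; map; foldr; filter)
  open import Data.List.Membership.Propositional using (_∈_)
  open import Data.List.Relation.Unary.AllPairs using (_∷_)
  open import Data.List.Relation.Unary.Any using (here; there)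
  open import Data.List.Relation.Unary.Unique.Propositional using (Unique)
  open import Data.List.Relation.Unary.Unique.Propositional.Properties using (Unique[x∷xs]⇒x∉xs)
  open import Function using (_∘_)
  open import Level using (Level)
  open import Relation.Binary.PropositionalEquality using (_≢_; refl)
  open import Relation.Nullary using (yes; no; ¬?)
  open import Relation.Unary using (Pred; Decidable)

  private
    variable
      a p : Level
      A : Set a

  open CommutativeRing R renaming (refl to ≈-refl; sym to ≈-sym; trans to ≈-trans)
  open import Algebra.Properties.CommutativeSemigroup +-commutativeSemigroup using (interchange; x∙yz≈y∙xz)
  open import Algebra.Properties.Ring ring using (-‿+-comm; -0#≈0#)
  open import Relation.Binary.Reasoning.Setoid setoid

  Σ : List A → (A → Carrier) → Carrier
  Σ xs g = foldr _+_ 0# (map g xs)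

  Σ-cong : ∀ (xs : List A) {g h} → (∀ {x} → x ∈ xs → g x ≈ h x) → Σ xs g ≈ Σ xs h
  Σ-cong []       _  = ≈-refl
  Σ-cong (x ∷ xs) eq = +-cong (eq (here refl)) (Σ-cong xs (eq ∘ there))

  Σ-++ : ∀ xs ys (g : A → Carrier) → Σ (xs ++ ys) g ≈ Σ xs g + Σ ys g
  Σ-++ []       ys g = ≈-sym (+-identityˡ _)
  Σ-++ (x ∷ xs) ys g = ≈-trans (+-congˡ (Σ-++ xs ys g)) (≈-sym (+-assoc _ _ _))

  Σ-+ : ∀ xs (g h : A → Carrier) → Σ xs (λ x → g x + h x) ≈ Σ xs g + Σ xs h
  Σ-+ []       g h = ≈-sym (+-identityˡ 0#)
  Σ-+ (x ∷ xs) g h = ≈-trans (+-congˡ (Σ-+ xs g h)) (interchange _ _ _ _)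

  Σ-neg : ∀ xs (g : A → Carrier) → Σ xs (λ x → - g x) ≈ - Σ xs g
  Σ-neg []       g = ≈-sym -0#≈0#
  Σ-neg (x ∷ xs) g = ≈-trans (+-congˡ (Σ-neg xs g)) (-‿+-comm _ _)

  Σ-zero : ∀ (xs : List A) {g} → (∀ {x} → x ∈ xs → g x ≈ 0#) → Σ xs g ≈ 0#
  Σ-zero []       _      = ≈-refl
  Σ-zero (x ∷ xs) vanish = ≈-trans (+-cong (vanish (here refl)) (Σ-zero xs (vanish ∘ there))) (+-identityˡ 0#)

  Σ-single : ∀ (xs : List A) {x} g → Unique xs → x ∈ xs →
             (∀ {y} → y ∈ xs → y ≢ x → g y ≈ 0#) → Σ xs g ≈ g x
  Σ-single _ g u@(_ ∷ _) (here {x = x} {xs = xs} refl) vanish = begin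
    g x + Σ xs g ≈⟨ +-congˡ (Σ-zero xs λ y∈ → vanish (there y∈) λ { refl → Unique[x∷xs]⇒x∉xs u y∈ }) ⟩
    g x + 0#     ≈⟨ +-identityʳ _ ⟩
    g x          ∎
  Σ-single _ {x} g u@(_ ∷ v) (there {x = y} {xs = xs} x∈) vanish = begin
    g y + Σ xs g ≈⟨ +-congʳ (vanish (here refl) λ { refl → Unique[x∷xs]⇒x∉xs u x∈ }) ⟩
    0# + Σ xs g  ≈⟨ +-identityˡ _ ⟩
    Σ xs g       ≈⟨ Σ-single xs g v x∈ (vanish ∘ there) ⟩
    g x          ∎

  Σ-filter : ∀ {P : Pred A p} (P? : Decidable P) xs g →
             Σ xs g ≈ Σ (filter P? xs) g + Σ (filter (¬? ∘ P?) xs) g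
  Σ-filter P? []       g = ≈-sym (+-identityˡ 0#)
  Σ-filter P? (x ∷ xs) g with P? x
  ... | yes _ = ≈-trans (+-congˡ (Σ-filter P? xs g)) (≈-sym (+-assoc _ _ _))
  ... | no  _ = ≈-trans (+-congˡ (Σ-filter P? xs g)) (x∙yz≈y∙xz _ _ _)


module GraphArcs where

  open import Data.Fin as Fin using (Fin; toℕ)
  open import Data.List using (List; length; map; filter; allFin; cartesianProduct; tabulate)
  open import Data.List.Membership.Propositional using (_∈_)
  open import Data.List.Membership.Propositional.Properties using (∈-lookup; ∈-filter⁺; ∈-filter⁻; ∈-cartesianProduct⁺; ∈-allFin)
  open import Data.List.Properties using (map-tabulate; tabulate-cong; length-tabulate; map-cong; filter-all)
  open import Data.List.Relation.Unary.All as All using ()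
  open import Data.List.Relation.Unary.Any as Any using ()
  open import Data.List.Relation.Unary.Any.Properties using (lookup-index)
  open import Data.List.Relation.Unary.Unique.Propositional using (Unique)
  open import Data.List.Relation.Unary.Unique.Propositional.Properties using (filter⁺; cartesianProduct⁺; allFin⁺)
  open import Data.Nat using (ℕ; zero; suc; _+_; _∸_; _<_; _<?_; s≤s; z≤n)
  open import Data.Nat.Combinatorics using (_C_; nC1≡n; nCk+nC[k+1]≡[n+1]C[k+1])
  open import Data.Nat.ListAction using (sum)
  open import Data.Nat.Properties using (+-suc; +-comm; +-identityʳ; m+n∸n≡m; n<1+n; <-trans)
  open import Data.Product using (∃-syntax; _,_; proj₁; proj₂)
  open import Function using (_∘_)
  open import Relation.Binary.PropositionalEquality using (_≡_; refl; sym; trans; cong; cong₂; module ≡-Reasoning)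
  open import Relation.Unary using (Decidable)

  open Lists

  module Arcs (d : ℕ) where

    ordered? : Decidable {A = Arc d} (λ ij → toℕ (proj₁ ij) < toℕ (proj₂ ij))
    ordered? ij = proj₁ ij Fin.<? proj₂ ij

    src tgt : Fin (nArcs d) → Fin d
    src = proj₁ ∘ arc {d}
    tgt = proj₂ ∘ arc {d}

    arcs-unique : Unique (arcs d)
    arcs-unique = filter⁺ ordered? (cartesianProduct⁺ (allFin⁺ d) (allFin⁺ d))

    ∈-arcs⁺ : ∀ {i j : Fin d} → toℕ i < toℕ j → (i , j) ∈ arcs d
    ∈-arcs⁺ {i} {j} = ∈-filter⁺ ordered? {xs = cartesianProduct (allFin d) (allFin d)} (∈-cartesianProduct⁺ (∈-allFin i) (∈-allFin j))

    ∈-arcs⁻ : ∀ {ij : Arc d} → ij ∈ arcs d → toℕ (proj₁ ij) < toℕ (proj₂ ij)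
    ∈-arcs⁻ = proj₂ ∘ ∈-filter⁻ ordered? {xs = cartesianProduct (allFin d) (allFin d)}

    src<tgt : ∀ k → toℕ (src k) < toℕ (tgt k)
    src<tgt = ∈-arcs⁻ ∘ ∈-lookup

    arc-injective : ∀ {k k'} → arc {d} k ≡ arc {d} k' → k ≡ k'
    arc-injective = lookup-injective arcs-unique

    long? : Decidable {A = Arc d} (λ ij → suc (toℕ (proj₁ ij)) < toℕ (proj₂ ij))
    long? ij = suc (toℕ (proj₁ ij)) <? toℕ (proj₂ ij)

    longArcs : List (Arc d)
    longArcs = filter long? (arcs d)

    arc-surjective : ∀ {i j : Fin d} → toℕ i < toℕ j → ∃[ k ] arc {d} k ≡ (i , j)
    arc-surjective i<j = Any.index (∈-arcs⁺ i<j) , sym (lookup-index (∈-arcs⁺ i<j))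

  _<ᶠ?_ : ∀ {d} k → Decidable (λ (j : Fin d) → k < toℕ j)
  k <ᶠ? j = k <? toℕ j

  count-allFin-> : ∀ k d → count (k <ᶠ?_) (allFin d) ≡ d ∸ suc k
  count-allFin-> k       zero    = refl
  count-allFin-> zero    (suc d) = begin
    count (0 <ᶠ?_) (tabulate (Fin.suc {d}))       ≡⟨ cong (count _) (map-tabulate (λ (i : Fin d) → i) Fin.suc) ⟨
    count (0 <ᶠ?_) (map Fin.suc (allFin d))       ≡⟨ count-map _ Fin.suc (allFin d) ⟩
    count (λ j → 0 <? suc (toℕ j)) (allFin d)
      ≡⟨ cong length (filter-all (λ j → 0 <? suc (toℕ j)) (All.universal (λ _ → s≤s z≤n) (allFin d))) ⟩
    length (allFin d)                             ≡⟨ length-tabulate (λ i → i) ⟩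
    d                                             ∎
    where open ≡-Reasoning
  count-allFin-> (suc k) (suc d) = begin
    count (suc k <ᶠ?_) (tabulate (Fin.suc {d}))       ≡⟨ cong (count _) (map-tabulate (λ (i : Fin d) → i) Fin.suc) ⟨
    count (suc k <ᶠ?_) (map Fin.suc (allFin d))       ≡⟨ count-map _ Fin.suc (allFin d) ⟩
    count (λ j → suc k <? suc (toℕ j)) (allFin d)     ≡⟨ count-cong _ (k <ᶠ?_) (λ _ → refl) (allFin d) ⟩
    count (k <ᶠ?_) (allFin d)                         ≡⟨ count-allFin-> k d ⟩
    d ∸ suc k                                         ∎
    where open ≡-Reasoning

  triangle : ℕ → ℕ → ℕ
  triangle c d = sum (map (λ i → d ∸ suc (c + toℕ i)) (allFin d))

  count-pairs-with-gap : ∀ c d →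
    count (λ ij → c + toℕ (proj₁ ij) <? toℕ (proj₂ ij)) (cartesianProduct (allFin d) (allFin d)) ≡ triangle c d
  count-pairs-with-gap c d = trans (count-cartesianProduct _ (allFin d) (allFin d))
                                   (cong sum (map-cong (λ i → count-allFin-> (c + toℕ i) d) (allFin d)))

  triangle-suc : ∀ c d → triangle c (suc d) ≡ (d ∸ c) + triangle c d
  triangle-suc c d = cong₂ _+_ (cong (d ∸_) (+-identityʳ c)) (cong sum (begin
    map f (tabulate Fin.suc)   ≡⟨ map-tabulate Fin.suc f ⟩
    tabulate (f ∘ Fin.suc)     ≡⟨ tabulate-cong (λ i → cong (d ∸_) (+-suc c (toℕ i))) ⟩
    tabulate g                 ≡⟨ map-tabulate (λ i → i) g ⟨
    map g (allFin d)           ∎))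
    where
    open ≡-Reasoning
    f : Fin (suc d) → ℕ
    f i = suc d ∸ suc (c + toℕ i)
    g : Fin d → ℕ
    g i = d ∸ suc (c + toℕ i)

  triangle0≡C2 : ∀ d → triangle 0 d ≡ d C 2
  triangle0≡C2 zero    = refl
  triangle0≡C2 (suc d) = begin
    triangle 0 (suc d)  ≡⟨ triangle-suc 0 d ⟩
    d + triangle 0 d    ≡⟨ cong₂ _+_ (sym (nC1≡n d)) (triangle0≡C2 d) ⟩
    d C 1 + d C 2       ≡⟨ nCk+nC[k+1]≡[n+1]C[k+1] d 1 ⟩
    suc d C 2           ∎
    where open ≡-Reasoning

  triangle1+d-1≡triangle0 : ∀ d → triangle 1 d + (d ∸ 1) ≡ triangle 0 d
  triangle1+d-1≡triangle0 zero    = refl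
  triangle1+d-1≡triangle0 (suc d) = begin
    triangle 1 (suc d) + d        ≡⟨ cong (_+ d) (trans (triangle-suc 1 d) (+-comm (d ∸ 1) _)) ⟩
    triangle 1 d + (d ∸ 1) + d    ≡⟨ cong (_+ d) (triangle1+d-1≡triangle0 d) ⟩
    triangle 0 d + d              ≡⟨ +-comm _ d ⟩
    d + triangle 0 d              ≡⟨ triangle-suc 0 d ⟨
    triangle 0 (suc d)            ∎
    where open ≡-Reasoning

  nArcs≡C2 : ∀ d → nArcs d ≡ d C 2
  nArcs≡C2 d = trans (count-pairs-with-gap 0 d) (triangle0≡C2 d)

  length-longArcs : ∀ d → length (Arcs.longArcs d) ≡ d C 2 ∸ (d ∸ 1)
  length-longArcs d = begin
    count long? (arcs d)                   ≡⟨ count-filter long? (Arcs.ordered? d) (<-trans (n<1+n _)) pairs ⟩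
    count long? pairs                      ≡⟨ count-pairs-with-gap 1 d ⟩
    triangle 1 d                           ≡⟨ m+n∸n≡m (triangle 1 d) (d ∸ 1) ⟨
    triangle 1 d + (d ∸ 1) ∸ (d ∸ 1)       ≡⟨ cong (_∸ (d ∸ 1)) (trans (triangle1+d-1≡triangle0 d) (triangle0≡C2 d)) ⟩
    d C 2 ∸ (d ∸ 1)                        ∎
    where
    open ≡-Reasoning
    open Arcs d using (long?)
    pairs : List (Arc d)
    pairs = cartesianProduct (allFin d) (allFin d)


module Monomials where

  open import Algebra.Bundles using (CommutativeRing)
  open import Data.Empty using (⊥-elim)
  open import Data.Fin using (Fin)
  open import Data.Fin.Properties as Fin using ()
  open import Data.List using (allFin)
  open import Data.List.Membership.Propositional.Properties using (∈-allFin)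
  open import Data.Nat as ℕ using (ℕ; _+_; _<_)
  open import Data.Nat.Properties as ℕ using (<-cmp; <-irrefl; <-trans; n≮0; +-monoˡ-<)
  open import Data.Product using (∃-syntax; _×_; _,_)
  open import Data.Product.Relation.Binary.Lex.Strict using (×-isStrictTotalOrder)
  open import Data.Product.Relation.Binary.Pointwise.NonDependent using (≡×≡⇒≡)
  open import Data.Sum using (_⊎_; inj₁; inj₂)
  open import Data.Vec as Vec using (Vec; lookup)
  open import Data.Vec.Properties using (lookup-zipWith; lookup-replicate; tabulate∘lookup; tabulate-cong; ≡-dec)
  open import Function using (_∘_)
  open import Level using (0ℓ)
  open import Relation.Binary using (Rel; IsStrictTotalOrder; Tri; tri<; tri≈; tri>)
  import Relation.Binary.Construct.Flip.EqAndOrd as Flip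
  open import Relation.Binary.PropositionalEquality using (_≡_; _≢_; refl; sym; trans; cong; subst; subst₂; resp₂; isEquivalence)
  open import Relation.Nullary using (¬_; yes; no; ¬?)
  open import Relation.Nullary.Decidable using (decidable-stable)

  open Lists
  open GraphArcs

  lookup-ext : ∀ {a} {A : Set a} {m} {u v : Vec A m} → (∀ k → lookup u k ≡ lookup v k) → u ≡ v
  lookup-ext {u = u} {v} eq = trans (sym (tabulate∘lookup u)) (trans (tabulate-cong eq) (tabulate∘lookup v))

  ≢0ᵐ⇒occurs : ∀ {n} {m : Mon n} → m ≢ 0ᵐ → ∃[ k ] 0 < lookup m k
  ≢0ᵐ⇒occurs {m = m} m≢0 with Fin.any? (λ k → 0 ℕ.<? lookup m k)
  ... | yes occurs = occurs
  ... | no  none   = ⊥-elim (m≢0 (lookup-ext λ k →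
    trans (ℕ.n≤0⇒n≡0 (ℕ.≮⇒≥ (none ∘ (k ,_)))) (sym (lookup-replicate k 0))))

  -- `varMon` and `pathMon` tabulate functions that are local to Defs; unifying
  -- `refl` against `Vec.tabulate f ≡ Vec.tabulate f` recovers them.
  tabulated-entry : ∀ {m} {f : Fin m → ℕ} → Vec.tabulate f ≡ Vec.tabulate f → Fin m → ℕ
  tabulated-entry {f = f} _ = f

  module LexOrder {c ℓ} (R : CommutativeRing c ℓ) (d : ℕ) where

    open GraphIdeal R d using (_≻var_; _≺lex_)

    infix 4 _⊏_

    _⊏_ : Rel (Fin (nArcs d)) 0ℓ
    k ⊏ k' = arc {d} k' ≻var arc {d} k

    ⊏-isStrictTotalOrder : IsStrictTotalOrder _≡_ _⊏_
    ⊏-isStrictTotalOrder = record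
      { isStrictPartialOrder = record
        { isEquivalence = isEquivalence
        ; irrefl        = λ { refl → ≻var.irrefl (refl , refl) }
        ; trans         = λ k⊏k' k'⊏k'' → ≻var.trans k'⊏k'' k⊏k'
        ; <-resp-≈      = resp₂ _⊏_
        }
      ; compare = compare
      }
      where
      module ≻var = IsStrictTotalOrder
        (×-isStrictTotalOrder Fin.<-isStrictTotalOrder (Flip.isStrictTotalOrder Fin.<-isStrictTotalOrder))
      open Arcs d using (arc-injective)
      compare : ∀ k k' → Tri (k ⊏ k') (k ≡ k') (k' ⊏ k)
      compare k k' with ≻var.compare (arc {d} k') (arc {d} k)
      ... | tri< k⊏k' k≢k' k'⊏̸k = tri< k⊏k' (λ { refl → k≢k' (refl , refl) }) k'⊏̸k
      ... | tri≈ k⊏̸k' k≡k' k'⊏̸k = tri≈ k⊏̸k' (sym (arc-injective (≡×≡⇒≡ k≡k'))) k'⊏̸k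
      ... | tri> k⊏̸k' k≢k' k'⊏k = tri> k⊏̸k' (λ { refl → k≢k' (refl , refl) }) k'⊏k

    open IsStrictTotalOrder ⊏-isStrictTotalOrder public using () renaming (compare to ⊏-compare; trans to ⊏-trans; irrefl to ⊏-irrefl)

    greatest-difference : ∀ {u v : Mon (nArcs d)} → u ≢ v →
      ∃[ k ] (lookup u k ≢ lookup v k × ∀ k' → k ⊏ k' → lookup u k' ≡ lookup v k')
    greatest-difference {u} {v} u≢v
      with greatest? ⊏-isStrictTotalOrder (λ k → ¬? (lookup u k ℕ.≟ lookup v k)) (allFin (nArcs d))
    ... | inj₁ none = ⊥-elim (u≢v (lookup-ext λ k → decidable-stable (_ ℕ.≟ _) (none (∈-allFin k))))
    ... | inj₂ (k , differ , above) = k , differ , λ k' k⊏k' → decidable-stable (_ ℕ.≟ _) (above (∈-allFin k') k⊏k')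

    ≺lex-irrefl : ∀ {u} → ¬ (u ≺lex u)
    ≺lex-irrefl (_ , u<u , _) = <-irrefl refl u<u

    ≺lex-trans : ∀ {u v w} → u ≺lex v → v ≺lex w → u ≺lex w
    ≺lex-trans {u} {v} {w} (k₁ , u<v , above₁) (k₂ , v<w , above₂) with ⊏-compare k₁ k₂
    ... | tri≈ _ refl _ =
      k₁ , <-trans u<v v<w , λ k' k₁⊏k' → trans (above₂ k' k₁⊏k') (above₁ k' k₁⊏k')
    ... | tri< k₁⊏k₂ _ _ =
      k₂ , subst (_< lookup w k₂) (above₁ k₂ k₁⊏k₂) v<w ,
      λ k' k₂⊏k' → trans (above₂ k' k₂⊏k') (above₁ k' (⊏-trans k₁⊏k₂ k₂⊏k'))
    ... | tri> _ _ k₂⊏k₁ =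
      k₁ , subst (lookup u k₁ <_) (sym (above₂ k₁ k₂⊏k₁)) u<v ,
      λ k' k₁⊏k' → trans (above₂ k' (⊏-trans k₂⊏k₁ k₁⊏k')) (above₁ k' k₁⊏k')

    ≢⇒≺lex⊎≻lex : ∀ {u v} → u ≢ v → u ≺lex v ⊎ v ≺lex u
    ≢⇒≺lex⊎≻lex {u} {v} u≢v with greatest-difference u≢v
    ... | k , differ , above with <-cmp (lookup u k) (lookup v k)
    ...   | tri< u<v _ _ = inj₁ (k , u<v , λ k' k⊏k' → sym (above k' k⊏k'))
    ...   | tri≈ _ same _ = ⊥-elim (differ same)
    ...   | tri> _ _ v<u = inj₂ (k , v<u , above)

    ≺lex-isStrictTotalOrder : IsStrictTotalOrder _≡_ _≺lex_
    ≺lex-isStrictTotalOrder = record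
      { isStrictPartialOrder = record
        { isEquivalence = isEquivalence
        ; irrefl        = λ { {u} refl → ≺lex-irrefl {u} }
        ; trans         = λ {u} {v} {w} → ≺lex-trans {u} {v} {w}
        ; <-resp-≈      = resp₂ _≺lex_
        }
      ; compare = compare
      }
      where
      compare : ∀ u v → Tri (u ≺lex v) (u ≡ v) (v ≺lex u)
      compare u v with ≡-dec ℕ._≟_ u v
      ... | yes refl = tri≈ (≺lex-irrefl {u}) refl (≺lex-irrefl {u})
      ... | no u≢v with ≢⇒≺lex⊎≻lex u≢v
      ...   | inj₁ u≺v = tri< u≺v u≢v (λ v≺u → ≺lex-irrefl {u} (≺lex-trans {u} {v} {u} u≺v v≺u))
      ...   | inj₂ v≺u = tri> (λ u≺v → ≺lex-irrefl {u} (≺lex-trans {u} {v} {u} u≺v v≺u)) u≢v v≺u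

    ≺lex-isTermOrder : IsTermOrder _≺lex_
    ≺lex-isTermOrder = record
      { isStrictTotalOrder = ≺lex-isStrictTotalOrder
      ; multiplicative     = multiplicative
      ; one-least          = one-least
      }
      where
      multiplicative : ∀ u v w → u ≺lex v → (u +ᵐ w) ≺lex (v +ᵐ w)
      multiplicative u v w (k , u<v , above) =
        k , subst₂ _<_ (sym (lookup-zipWith _+_ k u w)) (sym (lookup-zipWith _+_ k v w)) (+-monoˡ-< _ u<v) ,
        λ k' k⊏k' → trans (lookup-zipWith _+_ k' v w)
                          (trans (cong (_+ lookup w k') (above k' k⊏k')) (sym (lookup-zipWith _+_ k' u w)))
      one-least : ∀ u → u ≢ 0ᵐ → 0ᵐ ≺lex u
      one-least u u≢0 with ≢⇒≺lex⊎≻lex u≢0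
      ... | inj₁ (k , u<0 , _) = ⊥-elim (n≮0 (subst (lookup u k <_) (lookup-replicate k 0) u<0))
      ... | inj₂ 0≺u = 0≺u

module IncidenceMatrix where

  open import Algebra.Bundles using (CommutativeRing)
  open import Data.Empty using (⊥-elim)
  open import Data.Fin as Fin using (Fin; toℕ)
  open import Data.Fin.Properties as Fin using ()
  open import Data.Integer as ℤ using (ℤ; +_; 0ℤ; 1ℤ; _+_; _-_; _*_; -_)
  open import Data.Integer.Properties as ℤ using (+-*-commutativeRing)
  open import Data.Integer.Tactic.RingSolver using (solve-∀)
  open import Data.List as List using (List; allFin)
  open import Data.List.Membership.Propositional using (_∈_)
  open import Data.List.Membership.Propositional.Properties using (∈-allFin; ∈-filter⁻)
  open import Data.List.Relation.Unary.Unique.Propositional.Properties using (allFin⁺)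
  open import Data.Nat as ℕ using (ℕ; suc; _<_; _≤_)
  open import Data.Nat.Properties as ℕ using ()
  open import Data.Product using (∃-syntax; _×_; _,_; proj₁; proj₂)
  open import Data.Vec using (lookup)
  open import Data.Vec.Properties using (lookup-zipWith; lookup∘tabulate)
  open import Function using (_∘_)
  open import Level using (0ℓ)
  open import Relation.Binary using (Rel)
  open import Relation.Binary.PropositionalEquality using (_≡_; _≢_; refl; sym; trans; cong; cong₂; subst; module ≡-Reasoning)
  open import Relation.Nullary using (¬_; yes; no; Dec; _×-dec_; ¬?)
  open import Relation.Unary using (Pred; Decidable)

  open Lists
  open GraphArcs
  open Monomials

  module ℤΣ = ListSum +-*-commutativeRing
  open ℤΣ using (Σ)

  δ : ∀ {m} → Fin m → Fin m → ℤ
  δ v w with v Fin.≟ w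
  ... | yes _ = 1ℤ
  ... | no  _ = 0ℤ

  δ-refl : ∀ {m} (v : Fin m) → δ v v ≡ 1ℤ
  δ-refl v with v Fin.≟ v
  ... | yes _  = refl
  ... | no v≢v = ⊥-elim (v≢v refl)

  δ-≢ : ∀ {m} {v w : Fin m} → v ≢ w → δ v w ≡ 0ℤ
  δ-≢ {v = v} {w} v≢w with v Fin.≟ w
  ... | yes v≡w = ⊥-elim (v≢w v≡w)
  ... | no  _   = refl

  module _ {m} {X : Set} (e : X → Fin m × Fin m) where

    incidenceOf : Fin m → X → ℤ
    incidenceOf w x = δ w (proj₁ (e x)) - δ w (proj₂ (e x))

    outflow : List X → (X → ℤ) → Fin m → ℤ
    outflow xs c w = Σ xs (λ x → incidenceOf w x * c x)

    outflow-cong : ∀ xs {c c'} → (∀ {x} → x ∈ xs → c x ≡ c' x) → ∀ w → outflow xs c w ≡ outflow xs c' w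
    outflow-cong xs c≡c' w = ℤΣ.Σ-cong xs λ {x} x∈ → cong (incidenceOf w x *_) (c≡c' x∈)

    outflow-zero : ∀ xs {c} → (∀ {x} → x ∈ xs → c x ≡ 0ℤ) → ∀ w → outflow xs c w ≡ 0ℤ
    outflow-zero xs c≡0 w = ℤΣ.Σ-zero xs λ {x} x∈ → trans (cong (incidenceOf w x *_) (c≡0 x∈)) (ℤ.*-zeroʳ (incidenceOf w x))

    outflow-- : ∀ xs c c' w → outflow xs c w - outflow xs c' w ≡ outflow xs (λ x → c x - c' x) w
    outflow-- xs c c' w = begin
      outflow xs c w - outflow xs c' w                              ≡⟨ cong (λ t → outflow xs c w + t) (ℤΣ.Σ-neg xs _) ⟨
      outflow xs c w + Σ xs (λ x → - (incidenceOf w x * c' x))      ≡⟨ ℤΣ.Σ-+ xs _ _ ⟨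
      Σ xs (λ x → incidenceOf w x * c x - incidenceOf w x * c' x)   ≡⟨ ℤΣ.Σ-cong xs (λ {x} _ → distrib (incidenceOf w x) (c x) (c' x)) ⟩
      outflow xs (λ x → c x - c' x) w                               ∎
      where
      open ≡-Reasoning
      distrib : ∀ a b b' → a * b - a * b' ≡ a * (b - b')
      distrib = solve-∀

    outflow-split : ∀ xs c w →
      outflow xs c w ≡ Σ xs (λ x → δ w (proj₁ (e x)) * c x) - Σ xs (λ x → δ w (proj₂ (e x)) * c x)
    outflow-split xs c w = begin
      outflow xs c w
        ≡⟨ ℤΣ.Σ-cong xs (λ {x} _ → distrib (δ w (proj₁ (e x))) (δ w (proj₂ (e x))) (c x)) ⟩
      Σ xs (λ x → δ w (proj₁ (e x)) * c x + - (δ w (proj₂ (e x)) * c x))      ≡⟨ ℤΣ.Σ-+ xs _ _ ⟩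
      Σ xs (λ x → δ w (proj₁ (e x)) * c x) + Σ xs (λ x → - (δ w (proj₂ (e x)) * c x))
                                                                                 ≡⟨ cong (λ t → Σ xs _ + t) (ℤΣ.Σ-neg xs _) ⟩
      Σ xs (λ x → δ w (proj₁ (e x)) * c x) - Σ xs (λ x → δ w (proj₂ (e x)) * c x) ∎
      where
      open ≡-Reasoning
      distrib : ∀ a b c → (a - b) * c ≡ a * c + - (b * c)
      distrib = solve-∀

    outflow-filter : ∀ {p} {P : Pred X p} (P? : Decidable P) xs {c} → (∀ {x} → ¬ P x → c x ≡ 0ℤ) →
                     ∀ w → outflow xs c w ≡ outflow (List.filter P? xs) c w
    outflow-filter P? xs {c} outside w = begin
      outflow xs c w                                                  ≡⟨ ℤΣ.Σ-filter P? xs _ ⟩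
      outflow (List.filter P? xs) c w + outflow (List.filter (¬? ∘ P?) xs) c w
                                                                      ≡⟨ cong (λ t → outflow (List.filter P? xs) c w + t)
                                                                              (outflow-zero _ (outside ∘ proj₂ ∘ ∈-filter⁻ (¬? ∘ P?) {xs = xs}) w) ⟩
      outflow (List.filter P? xs) c w + 0ℤ                            ≡⟨ ℤ.+-identityʳ _ ⟩
      outflow (List.filter P? xs) c w                                 ∎
      where open ≡-Reasoning

  module Incidence (d : ℕ) where

    open Arcs d

    incidence≡incidenceOf : ∀ w k → incidence {d} w k ≡ incidenceOf (arc {d}) w k
    incidence≡incidenceOf w k with w Fin.≟ src k | w Fin.≟ tgt k
    ... | yes refl | yes w≡tgt = ⊥-elim (ℕ.<-irrefl (cong toℕ w≡tgt) (src<tgt k))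
    ... | yes _    | no  _     = refl
    ... | no  _    | yes _     = refl
    ... | no  _    | no  _     = refl

    ·A≡outflow : ∀ (w : Fin d) u → w ·A u ≡ outflow (arc {d}) (allFin (nArcs d)) (λ k → + lookup u k) w
    ·A≡outflow w u = ℤΣ.Σ-cong (allFin (nArcs d)) λ {k} _ → cong (_* + lookup u k) (incidence≡incidenceOf w k)

    infix 4 _~A_

    _~A_ : Rel (Mon (nArcs d)) 0ℓ
    u ~A v = ∀ (w : Fin d) → w ·A u ≡ w ·A v

    ·A-+ᵐ : ∀ (w : Fin d) u v → w ·A (u +ᵐ v) ≡ w ·A u + w ·A v
    ·A-+ᵐ w u v = trans (ℤΣ.Σ-cong (allFin (nArcs d)) λ {k} _ → distrib k) (ℤΣ.Σ-+ (allFin (nArcs d)) _ _)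
      where
      distrib : ∀ k → incidence w k * + lookup (u +ᵐ v) k ≡ incidence w k * + lookup u k + incidence w k * + lookup v k
      distrib k = trans (cong (λ t → incidence w k * + t) (lookup-zipWith ℕ._+_ k u v))
                        (trans (cong (incidence w k *_) (ℤ.pos-+ (lookup u k) (lookup v k)))
                               (ℤ.*-distribˡ-+ (incidence w k) _ _))

    +ᵐ-congˡ-~A : ∀ b {u v} → u ~A v → b +ᵐ u ~A b +ᵐ v
    +ᵐ-congˡ-~A b {u} {v} u~v w = trans (·A-+ᵐ w b u) (trans (cong (λ t → w ·A b + t) (u~v w)) (sym (·A-+ᵐ w b v)))

  module PathMonomials {c ℓ} (R : CommutativeRing c ℓ) (d : ℕ) where

    open GraphIdeal R d using (varMon; pathMon)
    open Arcs d
    open Incidence d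

    private
      variables : List (Fin (nArcs d))
      variables = allFin (nArcs d)

    varMon-at : ∀ {ij} k → arc {d} k ≡ ij → lookup (varMon ij) k ≡ 1
    varMon-at {ij} k arc≡ij = trans (lookup∘tabulate _ k) entry
      where
      entry : tabulated-entry (refl {x = varMon ij}) k ≡ 1
      entry with src k Fin.≟ proj₁ ij | tgt k Fin.≟ proj₂ ij
      ... | yes _ | yes _ = refl
      ... | no  ≢ | _     = ⊥-elim (≢ (cong proj₁ arc≡ij))
      ... | yes _ | no  ≢ = ⊥-elim (≢ (cong proj₂ arc≡ij))

    varMon-off : ∀ {ij} k → arc {d} k ≢ ij → lookup (varMon ij) k ≡ 0
    varMon-off {ij} k arc≢ij = trans (lookup∘tabulate _ k) entry
      where
      entry : tabulated-entry (refl {x = varMon ij}) k ≡ 0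
      entry with src k Fin.≟ proj₁ ij | tgt k Fin.≟ proj₂ ij
      ... | yes ≡₁ | yes ≡₂ = ⊥-elim (arc≢ij (cong₂ _,_ ≡₁ ≡₂))
      ... | no  _  | _      = refl
      ... | yes _  | no  _  = refl

    OnPath : Arc d → Arc d → Set
    OnPath ij ab = suc (toℕ (proj₁ ab)) ≡ toℕ (proj₂ ab) × toℕ (proj₁ ij) ≤ toℕ (proj₁ ab) × toℕ (proj₂ ab) ≤ toℕ (proj₂ ij)

    onPath? : ∀ ij ab → Dec (OnPath ij ab)
    onPath? ij ab = (_ ℕ.≟ _) ×-dec (_ ℕ.≤? _) ×-dec (_ ℕ.≤? _)

    pathMon-on : ∀ {ij} k → OnPath ij (arc {d} k) → lookup (pathMon ij) k ≡ 1
    pathMon-on {ij} k (p₁ , p₂ , p₃) = trans (lookup∘tabulate _ k) entry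
      where
      entry : tabulated-entry (refl {x = pathMon ij}) k ≡ 1
      entry with suc (toℕ (src k)) ℕ.≟ toℕ (tgt k) | toℕ (proj₁ ij) ℕ.≤? toℕ (src k) | toℕ (tgt k) ℕ.≤? toℕ (proj₂ ij)
      ... | yes _  | yes _  | yes _  = refl
      ... | no ¬p₁ | _      | _      = ⊥-elim (¬p₁ p₁)
      ... | yes _  | no ¬p₂ | _      = ⊥-elim (¬p₂ p₂)
      ... | yes _  | yes _  | no ¬p₃ = ⊥-elim (¬p₃ p₃)

    pathMon-off : ∀ {ij} k → ¬ OnPath ij (arc {d} k) → lookup (pathMon ij) k ≡ 0
    pathMon-off {ij} k off = trans (lookup∘tabulate _ k) entry
      where
      entry : tabulated-entry (refl {x = pathMon ij}) k ≡ 0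
      entry with suc (toℕ (src k)) ℕ.≟ toℕ (tgt k) | toℕ (proj₁ ij) ℕ.≤? toℕ (src k) | toℕ (tgt k) ℕ.≤? toℕ (proj₂ ij)
      ... | yes p₁ | yes p₂ | yes p₃ = ⊥-elim (off (p₁ , p₂ , p₃))
      ... | no _   | _      | _      = refl
      ... | yes _  | no _   | _      = refl
      ... | yes _  | yes _  | no _   = refl

    ·A-varMon : ∀ {i j : Fin d} → toℕ i < toℕ j → ∀ w → w ·A varMon (i , j) ≡ δ w i - δ w j
    ·A-varMon {i} {j} i<j w = begin
      w ·A varMon (i , j)                                    ≡⟨ ·A≡outflow w (varMon (i , j)) ⟩
      outflow arc variables (λ k → + lookup (varMon (i , j)) k) w
                                                             ≡⟨ ℤΣ.Σ-single variables _ (allFin⁺ _) (∈-allFin k₀) off ⟩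
      incidenceOf arc w k₀ * + lookup (varMon (i , j)) k₀  ≡⟨ cong (λ t → incidenceOf arc w k₀ * + t) (varMon-at k₀ arc≡ij) ⟩
      incidenceOf arc w k₀ * 1ℤ                             ≡⟨ ℤ.*-identityʳ _ ⟩
      δ w (src k₀) - δ w (tgt k₀)                            ≡⟨ cong (λ ij → δ w (proj₁ ij) - δ w (proj₂ ij)) arc≡ij ⟩
      δ w i - δ w j                                          ∎
      where
      open ≡-Reasoning
      k₀ : Fin (nArcs d)
      k₀ = proj₁ (arc-surjective i<j)
      arc≡ij : arc {d} k₀ ≡ (i , j)
      arc≡ij = proj₂ (arc-surjective i<j)
      off : ∀ {k} → k ∈ variables → k ≢ k₀ → incidenceOf arc w k * + lookup (varMon (i , j)) k ≡ 0ℤ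
      off {k} _ k≢k₀ = trans (cong (λ t → incidenceOf arc w k * + t) (varMon-off k (k≢k₀ ∘ arc-injective ∘ (λ e → trans e (sym arc≡ij)))))
                             (ℤ.*-zeroʳ (incidenceOf arc w k))

    on-path-src-injective : ∀ {ij k k'} → OnPath ij (arc {d} k) → OnPath ij (arc {d} k') → src k ≡ src k' → k ≡ k'
    on-path-src-injective (s≡t , _) (s≡t' , _) src≡ =
      arc-injective (cong₂ _,_ src≡ (Fin.toℕ-injective (trans (sym s≡t) (trans (cong (suc ∘ toℕ) src≡) s≡t'))))

    on-path-tgt-injective : ∀ {ij k k'} → OnPath ij (arc {d} k) → OnPath ij (arc {d} k') → tgt k ≡ tgt k' → k ≡ k'
    on-path-tgt-injective (s≡t , _) (s≡t' , _) tgt≡ =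
      arc-injective (cong₂ _,_ (Fin.toℕ-injective (ℕ.suc-injective (trans s≡t (trans (cong toℕ tgt≡) (sym s≡t'))))) tgt≡)

    vertex-after : ∀ {v u : Fin d} → toℕ v < toℕ u → ∃[ w ] suc (toℕ v) ≡ toℕ w
    vertex-after v<u = Fin.fromℕ< (ℕ.≤-<-trans v<u (Fin.toℕ<n _)) , sym (Fin.toℕ-fromℕ< _)

    vertex-before : ∀ {v : Fin d} → 0 < toℕ v → ∃[ w ] suc (toℕ w) ≡ toℕ v
    vertex-before {v} 0<v =
      Fin.fromℕ< (ℕ.≤-<-trans (ℕ.m∸n≤m (toℕ v) 1) (Fin.toℕ<n v)) , trans (cong suc (Fin.toℕ-fromℕ< _)) (ℕ.m+[n∸m]≡n 0<v)

    module _ {i j : Fin d} where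

      private
        p : Fin (nArcs d) → ℤ
        p k = + lookup (pathMon (i , j)) k

      pathDegree : (Fin (nArcs d) → Fin d) → Fin d → ℤ
      pathDegree end w = Σ variables (λ k → δ w (end k) * p k)

      private
        term-vanishes : ∀ (end : Fin (nArcs d) → Fin d) (w : Fin d) k → ¬ (OnPath (i , j) (arc {d} k) × end k ≡ w) → δ w (end k) * p k ≡ 0ℤ
        term-vanishes end w k ¬both = by-cases (w Fin.≟ end k) (onPath? (i , j) (arc {d} k))
          where
          by-cases : Dec (w ≡ end k) → Dec (OnPath (i , j) (arc {d} k)) → δ w (end k) * p k ≡ 0ℤ
          by-cases (no  w≢ek) _        = cong (_* p k) (δ-≢ w≢ek)
          by-cases (yes _)    (no off) = trans (cong (λ t → δ w (end k) * + t) (pathMon-off k off)) (ℤ.*-zeroʳ (δ w (end k)))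
          by-cases (yes w≡ek) (yes on) = ⊥-elim (¬both (on , sym w≡ek))

      pathDegree-one : ∀ (end : Fin (nArcs d) → Fin d) →
                       (∀ {k k'} → OnPath (i , j) (arc {d} k) → OnPath (i , j) (arc {d} k') → end k ≡ end k' → k ≡ k') →
                       ∀ {k₀} → OnPath (i , j) (arc {d} k₀) → pathDegree end (end k₀) ≡ 1ℤ
      pathDegree-one end end-injective {k₀} on₀ =
        trans (ℤΣ.Σ-single variables _ (allFin⁺ _) (∈-allFin k₀) off) (cong₂ _*_ (δ-refl (end k₀)) (cong +_ (pathMon-on k₀ on₀)))
        where
        off : ∀ {k} → k ∈ variables → k ≢ k₀ → δ (end k₀) (end k) * p k ≡ 0ℤ
        off {k} _ k≢k₀ = term-vanishes end (end k₀) k λ (on , same) → k≢k₀ (end-injective on on₀ same)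

      pathDegree-zero : ∀ (end : Fin (nArcs d) → Fin d) w → (∀ {k} → OnPath (i , j) (arc {d} k) → end k ≢ w) → pathDegree end w ≡ 0ℤ
      pathDegree-zero end w never = ℤΣ.Σ-zero variables λ {k} _ → term-vanishes end w k λ (on , same) → never on same

      leaving-inside : ∀ {w} → toℕ i ≤ toℕ w → toℕ w < toℕ j → pathDegree src w ≡ 1ℤ
      leaving-inside {w} i≤w w<j with vertex-after w<j
      ... | w' , sw≡w' with arc-surjective (ℕ.≤-reflexive sw≡w')
      ... | k₀ , arc≡ = subst (λ v → pathDegree src v ≡ 1ℤ) (cong proj₁ arc≡) (pathDegree-one src on-path-src-injective on₀)
        where
        on₀ : OnPath (i , j) (arc {d} k₀)
        on₀ = subst (OnPath (i , j)) (sym arc≡) (sw≡w' , i≤w , subst (_≤ toℕ j) sw≡w' w<j)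

      leaving-outside : ∀ {w} → ¬ (toℕ i ≤ toℕ w × toℕ w < toℕ j) → pathDegree src w ≡ 0ℤ
      leaving-outside {w} outside = pathDegree-zero src w λ (s≡t , i≤s , t≤j) src≡w →
        outside (subst (λ v → toℕ i ≤ toℕ v) src≡w i≤s , subst (λ v → toℕ v < toℕ j) src≡w (subst (_≤ toℕ j) (sym s≡t) t≤j))

      entering-inside : ∀ {w} → toℕ i < toℕ w → toℕ w ≤ toℕ j → pathDegree tgt w ≡ 1ℤ
      entering-inside {w} i<w w≤j with vertex-before (ℕ.≤-<-trans ℕ.z≤n i<w)
      ... | v , sv≡w with arc-surjective (ℕ.≤-reflexive sv≡w)
      ... | k₀ , arc≡ = subst (λ u → pathDegree tgt u ≡ 1ℤ) (cong proj₂ arc≡) (pathDegree-one tgt on-path-tgt-injective on₀)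
        where
        on₀ : OnPath (i , j) (arc {d} k₀)
        on₀ = subst (OnPath (i , j)) (sym arc≡) (sv≡w , ℕ.≤-pred (subst (suc (toℕ i) ≤_) (sym sv≡w) i<w) , w≤j)

      entering-outside : ∀ {w} → ¬ (toℕ i < toℕ w × toℕ w ≤ toℕ j) → pathDegree tgt w ≡ 0ℤ
      entering-outside {w} outside = pathDegree-zero tgt w λ (s≡t , i≤s , t≤j) tgt≡w →
        outside (subst (λ v → toℕ i < toℕ v) tgt≡w (subst (toℕ i <_) s≡t (ℕ.s≤s i≤s)) , subst (λ v → toℕ v ≤ toℕ j) tgt≡w t≤j)

    ·A-pathMon : ∀ {i j : Fin d} → toℕ i < toℕ j → ∀ w → w ·A pathMon (i , j) ≡ δ w i - δ w j
    ·A-pathMon {i} {j} i<j w = begin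
      w ·A pathMon (i , j)                                            ≡⟨ ·A≡outflow w (pathMon (i , j)) ⟩
      outflow arc variables (λ k → + lookup (pathMon (i , j)) k) w   ≡⟨ outflow-split arc variables _ w ⟩
      pathDegree src w - pathDegree tgt w                             ≡⟨ by-cases (w Fin.≟ i) (w Fin.≟ j) ⟩
      δ w i - δ w j                                                   ∎
      where
      open ≡-Reasoning
      by-cases : Dec (w ≡ i) → Dec (w ≡ j) → pathDegree src w - pathDegree tgt w ≡ δ w i - δ w j
      by-cases (yes refl) (yes refl) = ⊥-elim (ℕ.<-irrefl refl i<j)
      by-cases (yes refl) (no w≢j)   =
        cong₂ _-_ (trans (leaving-inside ℕ.≤-refl i<j) (sym (δ-refl w)))
                  (trans (entering-outside {w = w} (λ (w<w , _) → ℕ.<-irrefl refl w<w)) (sym (δ-≢ w≢j)))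
      by-cases (no w≢i)   (yes refl) =
        cong₂ _-_ (trans (leaving-outside {w = w} (λ (_ , w<w) → ℕ.<-irrefl refl w<w)) (sym (δ-≢ w≢i)))
                  (trans (entering-inside i<j ℕ.≤-refl) (sym (δ-refl w)))
      by-cases (no w≢i)   (no w≢j)   = trans (strictly-between? ((toℕ i ℕ.<? toℕ w) ×-dec (toℕ w ℕ.<? toℕ j)))
                                             (cong₂ _-_ (sym (δ-≢ w≢i)) (sym (δ-≢ w≢j)))
        where
        strictly-between? : Dec (toℕ i < toℕ w × toℕ w < toℕ j) → pathDegree src w - pathDegree tgt w ≡ 0ℤ - 0ℤ
        strictly-between? (yes (i<w , w<j)) = cong₂ _-_ (leaving-inside (ℕ.<⇒≤ i<w) w<j) (entering-inside i<w (ℕ.<⇒≤ w<j))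
        strictly-between? (no outside)      = cong₂ _-_
          (leaving-outside {w = w} λ (i≤w , w<j) → outside (ℕ.≤∧≢⇒< i≤w (λ i≡w → w≢i (sym (Fin.toℕ-injective i≡w))) , w<j))
          (entering-outside {w = w} λ (i<w , w≤j) → outside (i<w , ℕ.≤∧≢⇒< w≤j (w≢j ∘ Fin.toℕ-injective)))

    varMon~pathMon : ∀ {i j : Fin d} → toℕ i < toℕ j → varMon (i , j) ~A pathMon (i , j)
    varMon~pathMon i<j w = trans (·A-varMon i<j w) (sym (·A-pathMon i<j w))


module Circulations where

  open import Data.Empty using (⊥-elim)
  open import Data.Fin as Fin using (Fin; punchOut)
  open import Data.Fin.Properties as Fin using (punchOut-injective; punchOut-cong)
  open import Data.Integer as ℤ using (ℤ; 0ℤ; 1ℤ; _+_; _-_; _*_; -_)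
  open import Data.Integer.Properties as ℤ using ()
  open import Data.Integer.Tactic.RingSolver using (solve-∀)
  open import Data.List using (List; _∷_; length)
  open import Data.List.Membership.Propositional using (_∉_)
  open import Data.List.Relation.Unary.AllPairs using (_∷_)
  open import Data.List.Relation.Unary.Any using (here; there)
  open import Data.List.Relation.Unary.Unique.Propositional using (Unique)
  open import Data.List.Relation.Unary.Unique.Propositional.Properties using (Unique[x∷xs]⇒x∉xs)
  open import Data.Nat using (zero; suc; _≤_; s≤s)
  open import Data.Product using (∃-syntax; _×_; _,_; proj₁; proj₂)
  open import Function using (_∘_)
  open import Relation.Binary using (DecidableEquality)
  open import Relation.Binary.PropositionalEquality using (_≡_; _≢_; refl; sym; trans; cong; cong₂)
  open import Relation.Nullary using (yes; no; Dec)

  open Lists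
  open IncidenceMatrix

  module Contraction {m} {a b : Fin (suc (suc m))} (a≢b : a ≢ b) where

    redirect : Fin (suc (suc m)) → Fin (suc (suc m))
    redirect y with y Fin.≟ b
    ... | yes _ = a
    ... | no  _ = y

    redirect-b : redirect b ≡ a
    redirect-b with b Fin.≟ b
    ... | yes _  = refl
    ... | no b≢b = ⊥-elim (b≢b refl)

    redirect-≢b : ∀ {y} → y ≢ b → redirect y ≡ y
    redirect-≢b {y} y≢b with y Fin.≟ b
    ... | yes y≡b = ⊥-elim (y≢b y≡b)
    ... | no  _   = refl

    redirect≢b : ∀ y → redirect y ≢ b
    redirect≢b y with y Fin.≟ b
    ... | yes _   = a≢b
    ... | no  y≢b = y≢b

    merge : Fin (suc (suc m)) → Fin (suc m)
    merge y = punchOut (redirect≢b y ∘ sym)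

    δ-merge : ∀ v w → δ (merge v) (merge w) ≡ δ (redirect v) (redirect w)
    δ-merge v w with redirect v Fin.≟ redirect w
    ... | yes same = trans (cong (δ (merge v)) (sym (punchOut-cong b same))) (δ-refl (merge v))
    ... | no  diff = δ-≢ (diff ∘ punchOut-injective (redirect≢b v ∘ sym) (redirect≢b w ∘ sym))

    δ-merge-away : ∀ {w} → w ≢ a → w ≢ b → ∀ y → δ (merge w) (merge y) ≡ δ w y
    δ-merge-away {w} w≢a w≢b y = trans (δ-merge w y) (trans (cong (λ v → δ v (redirect y)) (redirect-≢b w≢b)) (by-cases (y Fin.≟ b)))
      where
      by-cases : Dec (y ≡ b) → δ w (redirect y) ≡ δ w y
      by-cases (yes refl) = trans (cong (δ w) redirect-b) (trans (δ-≢ w≢a) (sym (δ-≢ w≢b)))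
      by-cases (no  y≢b)  = cong (δ w) (redirect-≢b y≢b)

    δ-merge-a : ∀ y → δ (merge a) (merge y) ≡ δ a y + δ b y
    δ-merge-a y = trans (δ-merge a y) (trans (cong (λ v → δ v (redirect y)) (redirect-≢b a≢b)) (by-cases (y Fin.≟ b)))
      where
      by-cases : Dec (y ≡ b) → δ a (redirect y) ≡ δ a y + δ b y
      by-cases (yes refl) = trans (cong (δ a) redirect-b) (trans (δ-refl a) (sym (cong₂ _+_ (δ-≢ a≢b) (δ-refl b))))
      by-cases (no  y≢b)  = trans (cong (δ a) (redirect-≢b y≢b)) (sym (trans (cong (δ a y +_) (δ-≢ (y≢b ∘ sym))) (ℤ.+-identityʳ _)))

    module _ {X : Set} (e : X → Fin (suc (suc m)) × Fin (suc (suc m))) where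

      contract : X → Fin (suc m) × Fin (suc m)
      contract x = merge (proj₁ (e x)) , merge (proj₂ (e x))

      outflow-contract-away : ∀ {w} → w ≢ a → w ≢ b → ∀ xs c → outflow contract xs c (merge w) ≡ outflow e xs c w
      outflow-contract-away w≢a w≢b xs c = ℤΣ.Σ-cong xs λ {x} _ →
        cong (_* c x) (cong₂ _-_ (δ-merge-away w≢a w≢b (proj₁ (e x))) (δ-merge-away w≢a w≢b (proj₂ (e x))))

      outflow-contract-a : ∀ xs c → outflow contract xs c (merge a) ≡ outflow e xs c a + outflow e xs c b
      outflow-contract-a xs c = trans (ℤΣ.Σ-cong xs λ {x} _ → step x) (ℤΣ.Σ-+ xs _ _)
        where
        distrib : ∀ p q r s t → ((p + q) - (r + s)) * t ≡ (p - r) * t + (q - s) * t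
        distrib = solve-∀
        step : ∀ x → incidenceOf contract (merge a) x * c x ≡ incidenceOf e a x * c x + incidenceOf e b x * c x
        step x = trans (cong (_* c x) (cong₂ _-_ (δ-merge-a (proj₁ (e x))) (δ-merge-a (proj₂ (e x)))))
                       (distrib (δ a (proj₁ (e x))) (δ b (proj₁ (e x))) (δ a (proj₂ (e x))) (δ b (proj₂ (e x))) (c x))

  record NontrivialCirculation {m} {X : Set} (e : X → Fin m × Fin m) (xs : List X) : Set where
    field
      weight         : X → ℤ
      weight-outside : ∀ {x} → x ∉ xs → weight x ≡ 0ℤ
      weight-nonzero : ∃[ x ] weight x ≢ 0ℤ
      balanced       : ∀ w → outflow e xs weight w ≡ 0ℤ

  module _ {X : Set} (_≟_ : DecidableEquality X) where

    _[_≔_] : (X → ℤ) → X → ℤ → X → ℤ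
    (c [ x₀ ≔ t ]) x with x ≟ x₀
    ... | yes _ = t
    ... | no  _ = c x

    update-≡ : ∀ c x₀ t → (c [ x₀ ≔ t ]) x₀ ≡ t
    update-≡ c x₀ t with x₀ ≟ x₀
    ... | yes _    = refl
    ... | no x₀≢x₀ = ⊥-elim (x₀≢x₀ refl)

    update-≢ : ∀ c {x x₀} t → x ≢ x₀ → (c [ x₀ ≔ t ]) x ≡ c x
    update-≢ c {x} {x₀} t x≢x₀ with x ≟ x₀
    ... | yes x≡x₀ = ⊥-elim (x≢x₀ x≡x₀)
    ... | no  _    = refl

    module _ {m} (e : X → Fin m × Fin m) {x₀ : X} {rest : List X} (x₀∉rest : x₀ ∉ rest) where

      outflow-update : ∀ c t w → outflow e (x₀ ∷ rest) (c [ x₀ ≔ t ]) w ≡ incidenceOf e w x₀ * t + outflow e rest c w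
      outflow-update c t w = cong₂ _+_ (cong (incidenceOf e w x₀ *_) (update-≡ c x₀ t))
                                       (outflow-cong e rest (λ x∈ → update-≢ c t λ { refl → x₀∉rest x∈ }) w)

      loop-circulation : proj₁ (e x₀) ≡ proj₂ (e x₀) → NontrivialCirculation e (x₀ ∷ rest)
      loop-circulation loop = record
        { weight         = (λ _ → 0ℤ) [ x₀ ≔ 1ℤ ]
        ; weight-outside = λ x∉ → update-≢ _ 1ℤ (x∉ ∘ here)
        ; weight-nonzero = x₀ , λ 1≡0 → 1≢0 (trans (sym (update-≡ _ x₀ 1ℤ)) 1≡0)
        ; balanced       = λ w → trans (outflow-update _ 1ℤ w)
                                       (cong₂ _+_ (no-incidence w) (outflow-zero e rest (λ _ → refl) w))
        }
        where
        1≢0 : 1ℤ ≢ 0ℤ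
        1≢0 ()
        no-incidence : ∀ w → incidenceOf e w x₀ * 1ℤ ≡ 0ℤ
        no-incidence w = trans (ℤ.*-identityʳ _)
                               (trans (cong (λ v → δ w (proj₁ (e x₀)) - δ w v) (sym loop)) (ℤ.+-inverseʳ (δ w (proj₁ (e x₀)))))

    module _ {m} (e : X → Fin (suc (suc m)) × Fin (suc (suc m))) {x₀ : X} {rest : List X} (x₀∉rest : x₀ ∉ rest)
             (a≢b : proj₁ (e x₀) ≢ proj₂ (e x₀)) where

      open Contraction a≢b using (merge; contract; outflow-contract-away; outflow-contract-a)

      -- Weight −s on x₀ = (a , b) restores the balance at a; the balance at b then
      -- follows from the balance at the merged vertex.
      extend-contracted : NontrivialCirculation (contract e) rest → NontrivialCirculation e (x₀ ∷ rest)
      extend-contracted C = record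
        { weight         = weight [ x₀ ≔ - s ]
        ; weight-outside = λ x∉ → trans (update-≢ weight (- s) (x∉ ∘ here)) (weight-outside (x∉ ∘ there))
        ; weight-nonzero = x₁ , λ w≡0 → weight-x₁≢0 (trans (sym (update-≢ weight (- s) x₁≢x₀)) w≡0)
        ; balanced       = λ w → trans (outflow-update e x₀∉rest weight (- s) w) (by-cases w (w Fin.≟ a) (w Fin.≟ b))
        }
        where
        open NontrivialCirculation C
        a b : Fin (suc (suc m))
        a = proj₁ (e x₀)
        b = proj₂ (e x₀)
        s : ℤ
        s = outflow e rest weight a
        x₁ : X
        x₁ = proj₁ weight-nonzero
        weight-x₁≢0 : weight x₁ ≢ 0ℤ
        weight-x₁≢0 = proj₂ weight-nonzero
        x₁≢x₀ : x₁ ≢ x₀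
        x₁≢x₀ refl = weight-x₁≢0 (weight-outside x₀∉rest)
        by-cases : ∀ w → Dec (w ≡ a) → Dec (w ≡ b) → incidenceOf e w x₀ * - s + outflow e rest weight w ≡ 0ℤ
        by-cases w (yes refl) _ = trans (cong (λ i → i * - s + s) (cong₂ _-_ (δ-refl a) (δ-≢ a≢b))) (cancel s)
          where
          cancel : ∀ s → (1ℤ - 0ℤ) * - s + s ≡ 0ℤ
          cancel = solve-∀
        by-cases w (no w≢a) (yes refl) =
          trans (cong (λ i → i * - s + outflow e rest weight b) (cong₂ _-_ (δ-≢ w≢a) (δ-refl b)))
                (trans (cancel s (outflow e rest weight b)) (trans (sym (outflow-contract-a e rest weight)) (balanced (merge a))))
          where
          cancel : ∀ s t → (0ℤ - 1ℤ) * - s + t ≡ s + t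
          cancel = solve-∀
        by-cases w (no w≢a) (no w≢b) =
          trans (cong (λ i → i * - s + outflow e rest weight w) (cong₂ _-_ (δ-≢ w≢a) (δ-≢ w≢b)))
                (trans (ℤ.+-identityˡ _) (trans (sym (outflow-contract-away e w≢a w≢b rest weight)) (balanced (merge w))))

    nontrivialCirculation : ∀ {m} (e : X → Fin (suc m) × Fin (suc m)) xs → Unique xs → suc m ≤ length xs →
                            NontrivialCirculation e xs
    nontrivialCirculation {zero}  e (x₀ ∷ rest) u _ = loop-circulation e (Unique[x∷xs]⇒x∉xs u) (one-vertex _ _)
      where
      one-vertex : ∀ (v w : Fin 1) → v ≡ w
      one-vertex Fin.zero Fin.zero = refl
    nontrivialCirculation {suc m} e (x₀ ∷ rest) u@(_ ∷ u-rest) (s≤s enough) with proj₁ (e x₀) Fin.≟ proj₂ (e x₀)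
    ... | yes loop = loop-circulation e (Unique[x∷xs]⇒x∉xs u) loop
    ... | no  a≢b  = extend-contracted e (Unique[x∷xs]⇒x∉xs u) a≢b
                       (nontrivialCirculation (Contraction.contract a≢b e) rest u-rest enough)


NonTrivial : ∀ {c ℓ} → CommutativeRing c ℓ → Set ℓ
NonTrivial K = ¬ 0# ≈ 1#
  where open CommutativeRing K


module Coefficients {c ℓ} (R : CommutativeRing c ℓ) (n : ℕ) where

  open import Algebra.Bundles using (CommutativeRing)
  open import Data.Empty using (⊥-elim)
  open import Data.List using (List; []; _∷_; _++_; map; deduplicate)
  open import Data.List.Membership.Propositional using (_∈_)
  open import Data.List.Membership.Propositional.Properties using (∈-map⁺; ∈-++⁺ˡ; ∈-++⁺ʳ; ∈-deduplicate⁺; ∈-deduplicate⁻)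
  open import Data.List.Relation.Unary.All using (All; []; _∷_)
  open import Data.List.Relation.Unary.Any using (here; there)
  open import Data.List.Relation.Unary.Unique.DecPropositional.Properties using (deduplicate-!)
  open import Data.List.Relation.Unary.Unique.Propositional using (Unique)
  open import Data.Nat as ℕ using (ℕ)
  open import Data.Nat.Properties as ℕ using ()
  open import Data.Product using (_×_; _,_; proj₁; proj₂)
  open import Data.Sum using (_⊎_; inj₁; inj₂; [_,_]′)
  open import Data.Vec.Properties using (≡-dec; zipWith-identityˡ)
  open import Function using (_∘_)
  open import Level using (0ℓ)
  open import Relation.Binary using (Rel; DecidableEquality; Asymmetric)
  open import Relation.Binary.PropositionalEquality using (_≡_; _≢_; refl; sym; cong)
  open import Relation.Nullary using (¬_; yes; no; Dec)
  open import Relation.Unary using (Pred; Decidable)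

  open Lists

  open CommutativeRing R renaming (refl to ≈-refl; sym to ≈-sym; trans to ≈-trans)
  open Poly R n
  open ListSum R
  open import Relation.Binary.Reasoning.Setoid setoid

  _≟ᵐ_ : DecidableEquality (Mon n)
  _≟ᵐ_ = ≡-dec ℕ._≟_

  infixl 7 _when_

  _when_ : ∀ {p} {P : Set p} → Carrier → Dec P → Carrier
  a when yes _ = a
  a when no  _ = 0#

  module _ {p} {P : Set p} where

    when-cong : ∀ (P? : Dec P) {a b} → a ≈ b → a when P? ≈ b when P?
    when-cong (yes _) a≈b = a≈b
    when-cong (no  _) _   = ≈-refl

    when-+ : ∀ (P? : Dec P) a b → (a + b) when P? ≈ a when P? + b when P?
    when-+ (yes _) a b = ≈-refl
    when-+ (no  _) a b = ≈-sym (+-identityˡ 0#)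

    0#-when : ∀ (P? : Dec P) → 0# when P? ≈ 0#
    0#-when (yes _) = ≈-refl
    0#-when (no  _) = ≈-refl

    when-yes : ∀ (P? : Dec P) a → P → a when P? ≈ a
    when-yes (yes _) a _  = ≈-refl
    when-yes (no ¬p) a p  = ⊥-elim (¬p p)

    when-no : ∀ (P? : Dec P) a → ¬ P → a when P? ≈ 0#
    when-no (yes p) a ¬p = ⊥-elim (¬p p)
    when-no (no  _) a _  = ≈-refl

  coeff-∷ : ∀ m a b f → coeff m ((a , b) ∷ f) ≈ a when (m ≟ᵐ b) + coeff m f
  coeff-∷ m a b f with ≡-dec ℕ._≟_ m b
  ... | yes _ = ≈-refl
  ... | no  _ = ≈-sym (+-identityˡ _)

  coeff-++ : ∀ m f g → coeff m (f ++ g) ≈ coeff m f + coeff m g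
  coeff-++ m []            g = ≈-sym (+-identityˡ _)
  coeff-++ m ((a , b) ∷ f) g = begin
    coeff m ((a , b) ∷ (f ++ g))                 ≈⟨ coeff-∷ m a b (f ++ g) ⟩
    a when (m ≟ᵐ b) + coeff m (f ++ g)           ≈⟨ +-congˡ (coeff-++ m f g) ⟩
    a when (m ≟ᵐ b) + (coeff m f + coeff m g)    ≈⟨ +-assoc _ _ _ ⟨
    (a when (m ≟ᵐ b) + coeff m f) + coeff m g    ≈⟨ +-congʳ (coeff-∷ m a b f) ⟨
    coeff m ((a , b) ∷ f) + coeff m g            ∎

  module _ {p} {P : Pred (Mon n) p} (P? : Decidable P) where

    coeffSum : Polynomial → Carrier
    coeffSum f = Σ f (λ (a , m) → a when P? m)

    coeffSum-over : ∀ (S : List (Mon n)) → Unique S → ∀ f → (∀ {t} → t ∈ f → proj₂ t ∈ S) →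
                    coeffSum f ≈ Σ S (λ m → coeff m f when P? m)
    coeffSum-over S uS []            _   = ≈-sym (Σ-zero S λ {m} _ → 0#-when (P? m))
    coeffSum-over S uS ((a , b) ∷ f) f⊆S = begin
      a when P? b + coeffSum f
        ≈⟨ +-congˡ (coeffSum-over S uS f (f⊆S ∘ there)) ⟩
      a when P? b + Σ S (λ m → coeff m f when P? m)
        ≈⟨ +-congʳ (≈-sym head) ⟩
      Σ S (λ m → a when (m ≟ᵐ b) when P? m) + Σ S (λ m → coeff m f when P? m)
        ≈⟨ Σ-+ S _ _ ⟨
      Σ S (λ m → a when (m ≟ᵐ b) when P? m + coeff m f when P? m)
        ≈⟨ Σ-cong S (λ {m} _ → ≈-sym (≈-trans (when-cong (P? m) (coeff-∷ m a b f)) (when-+ (P? m) _ _))) ⟩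
      Σ S (λ m → coeff m ((a , b) ∷ f) when P? m) ∎
      where
      head : Σ S (λ m → a when (m ≟ᵐ b) when P? m) ≈ a when P? b
      head = ≈-trans (Σ-single S (λ m → a when (m ≟ᵐ b) when P? m) uS (f⊆S (here refl))
                                 (λ {m} _ m≢b → ≈-trans (when-cong (P? m) (when-no (m ≟ᵐ b) a m≢b)) (0#-when (P? m))))
                     (when-cong (P? b) (when-yes (b ≟ᵐ b) a refl))

    coeffSum-cong : ∀ {f g} → f ≈ₚ g → coeffSum f ≈ coeffSum g
    coeffSum-cong {f} {g} f≈g = begin
      coeffSum f                        ≈⟨ coeffSum-over S (deduplicate-! _≟ᵐ_ monomials) f
                                             (∈-deduplicate⁺ _≟ᵐ_ ∘ ∈-++⁺ˡ ∘ ∈-map⁺ proj₂) ⟩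
      Σ S (λ m → coeff m f when P? m)   ≈⟨ Σ-cong S (λ {m} _ → when-cong (P? m) (f≈g m)) ⟩
      Σ S (λ m → coeff m g when P? m)   ≈⟨ coeffSum-over S (deduplicate-! _≟ᵐ_ monomials) g
                                             (∈-deduplicate⁺ _≟ᵐ_ ∘ ∈-++⁺ʳ (map proj₂ f) ∘ ∈-map⁺ proj₂) ⟨
      coeffSum g                        ∎
      where
      monomials S : List (Mon n)
      monomials = map proj₂ f ++ map proj₂ g
      S = deduplicate _≟ᵐ_ monomials

    coeffSum-++ : ∀ f g → coeffSum (f +ₚ g) ≈ coeffSum f + coeffSum g
    coeffSum-++ f g = Σ-++ f g _

    coeffSum-ideal : ∀ {q} (G : Pred Polynomial q) → (∀ {g} → G g → ∀ h → coeffSum (h *ₚ g) ≈ 0#) →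
                     ∀ {f} → ⟨ G ⟩ f → coeffSum f ≈ 0#
    coeffSum-ideal G vanishes {f} (hgs , G-hgs , f≈) =
      ≈-trans (coeffSum-cong {f} {sumₚ (map (λ hg → proj₁ hg *ₚ proj₂ hg) hgs)} f≈) (combination G-hgs)
      where
      combination : ∀ {hgs} → All (G ∘ proj₂) hgs → coeffSum (sumₚ (map (λ hg → proj₁ hg *ₚ proj₂ hg) hgs)) ≈ 0#
      combination []                   = ≈-refl
      combination {(h , g) ∷ _} (Gg ∷ rest) =
        ≈-trans (coeffSum-++ (h *ₚ g) _) (≈-trans (+-cong (vanishes Gg h) (combination rest)) (+-identityˡ 0#))

    coeffSum-binomial : ∀ u v → (∀ b → (P (b +ᵐ u) → P (b +ᵐ v)) × (P (b +ᵐ v) → P (b +ᵐ u))) →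
                        ∀ h → coeffSum (h *ₚ binomial u v) ≈ 0#
    coeffSum-binomial u v _     []            = ≈-refl
    coeffSum-binomial u v P-inv ((a , b) ∷ h) =
      ≈-trans (coeffSum-++ ((a * 1# , b +ᵐ u) ∷ (a * - 1# , b +ᵐ v) ∷ []) (h *ₚ binomial u v))
              (≈-trans (+-cong (cancel (P? (b +ᵐ u)) (P? (b +ᵐ v))) (coeffSum-binomial u v P-inv h)) (+-identityˡ 0#))
      where
      cancel : (Pu? : Dec (P (b +ᵐ u))) (Pv? : Dec (P (b +ᵐ v))) → a * 1# when Pu? + (a * - 1# when Pv? + 0#) ≈ 0#
      cancel (yes _)  (yes _)  = begin
        a * 1# + (a * - 1# + 0#)  ≈⟨ +-congˡ (+-identityʳ _) ⟩
        a * 1# + a * - 1#         ≈⟨ distribˡ a 1# (- 1#) ⟨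
        a * (1# + - 1#)           ≈⟨ *-congˡ (-‿inverseʳ 1#) ⟩
        a * 0#                    ≈⟨ zeroʳ a ⟩
        0#                        ∎
      cancel (no _)   (no _)   = ≈-trans (+-identityˡ _) (+-identityˡ 0#)
      cancel (yes Pu) (no ¬Pv) = ⊥-elim (¬Pv (proj₁ (P-inv b) Pu))
      cancel (no ¬Pu) (yes Pv) = ⊥-elim (¬Pu (proj₂ (P-inv b) Pv))

    coeffSum-single : ∀ f {m} → P m → (∀ {m'} → m' ∈ map proj₂ f → P m' → m' ≢ m → coeff m' f ≈ 0#) →
                      coeffSum f ≈ coeff m f
    coeffSum-single f {m} Pm others = begin
      coeffSum f                        ≈⟨ coeffSum-over S (deduplicate-! _≟ᵐ_ (m ∷ map proj₂ f)) f
                                             (∈-deduplicate⁺ _≟ᵐ_ ∘ there ∘ ∈-map⁺ proj₂) ⟩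
      Σ S (λ m' → coeff m' f when P? m') ≈⟨ Σ-single S _ (deduplicate-! _≟ᵐ_ (m ∷ map proj₂ f))
                                              (∈-deduplicate⁺ _≟ᵐ_ {xs = m ∷ map proj₂ f} (here refl)) vanish ⟩
      coeff m f when P? m               ≈⟨ when-yes (P? m) _ Pm ⟩
      coeff m f                         ∎
      where
      S : List (Mon n)
      S = deduplicate _≟ᵐ_ (m ∷ map proj₂ f)
      vanish : ∀ {m'} → m' ∈ S → m' ≢ m → coeff m' f when P? m' ≈ 0#
      vanish {m'} m'∈S m'≢m with ∈-deduplicate⁻ _≟ᵐ_ (m ∷ map proj₂ f) m'∈S | P? m'
      ... | _            | no  _   = ≈-refl
      ... | here m'≡m    | yes _   = ⊥-elim (m'≢m m'≡m)
      ... | there m'∈f   | yes Pm' = others m'∈f Pm' m'≢m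

  coeff-binomial : ∀ m u v → coeff m (binomial u v) ≈ 1# when (m ≟ᵐ u) + (- 1# when (m ≟ᵐ v) + 0#)
  coeff-binomial m u v = ≈-trans (coeff-∷ m 1# u _) (+-congˡ (coeff-∷ m (- 1#) v []))

  binomial-support : ∀ {m u v} → ¬ coeff m (binomial u v) ≈ 0# → m ≡ u ⊎ m ≡ v
  binomial-support {m} {u} {v} nonzero = by-cases (m ≟ᵐ u) (m ≟ᵐ v)
    where
    by-cases : Dec (m ≡ u) → Dec (m ≡ v) → m ≡ u ⊎ m ≡ v
    by-cases (yes m≡u) _         = inj₁ m≡u
    by-cases (no  _)   (yes m≡v) = inj₂ m≡v
    by-cases (no  m≢u) (no  m≢v) = ⊥-elim (nonzero (≈-trans (coeff-binomial m u v)
      (≈-trans (+-cong (when-no (m ≟ᵐ u) 1# m≢u) (+-congʳ (when-no (m ≟ᵐ v) (- 1#) m≢v)))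
               (≈-trans (+-identityˡ _) (+-identityˡ 0#)))))

  coeff-binomial-lead : ∀ {u v} → u ≢ v → coeff u (binomial u v) ≈ 1#
  coeff-binomial-lead {u} {v} u≢v = ≈-trans (coeff-binomial u u v)
    (≈-trans (+-cong (when-yes (u ≟ᵐ u) 1# refl) (≈-trans (+-congʳ (when-no (u ≟ᵐ v) (- 1#) u≢v)) (+-identityˡ 0#)))
             (+-identityʳ 1#))

  module _ {_≺_ : Rel (Mon n) 0ℓ} where

    LM-binomial : NonTrivial R → ∀ {u v} → v ≺ u → u ≢ v → LM _≺_ (binomial u v) u
    LM-binomial 0≉1 {u} {v} v≺u u≢v = (λ lead≈0 → 0≉1 (≈-trans (≈-sym lead≈0) (coeff-binomial-lead u≢v)))
                                    , λ m nonzero → [ inj₁ , (λ { refl → inj₂ v≺u }) ]′ (binomial-support nonzero)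

    LM-unique : Asymmetric _≺_ → ∀ {f m m'} → LM _≺_ f m → LM _≺_ f m' → m ≡ m'
    LM-unique asym {m = m} {m'} (nonzero , below) (nonzero' , below') with below m' nonzero' | below' m nonzero
    ... | inj₁ m'≡m  | _          = sym m'≡m
    ... | inj₂ _     | inj₁ m≡m'  = m≡m'
    ... | inj₂ m'≺m  | inj₂ m≺m'  = ⊥-elim (asym m≺m' m'≺m)

  *ₚ-identityˡ : ∀ f → (mono 0ᵐ *ₚ f) ≈ₚ f
  *ₚ-identityˡ []            m = ≈-refl
  *ₚ-identityˡ ((a , b) ∷ f) m = begin
    coeff m ((1# * a , 0ᵐ +ᵐ b) ∷ (mono 0ᵐ *ₚ f))     ≈⟨ coeff-∷ m _ _ _ ⟩
    1# * a when (m ≟ᵐ (0ᵐ +ᵐ b)) + coeff m (mono 0ᵐ *ₚ f)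
      ≈⟨ +-cong (≈-trans (when-cong (m ≟ᵐ _) (*-identityˡ a))
                         (reflexive (cong (λ b' → a when (m ≟ᵐ b')) (zipWith-identityˡ ℕ.+-identityˡ b))))
                (*ₚ-identityˡ f m) ⟩
    a when (m ≟ᵐ b) + coeff m f                        ≈⟨ coeff-∷ m a b f ⟨
    coeff m ((a , b) ∷ f)                              ∎

  generator∈⟨⟩ : ∀ {q} {G : Pred Polynomial q} {f} → G f → ⟨ G ⟩ f
  generator∈⟨⟩ {f = f} Gf = (mono 0ᵐ , f) ∷ [] , Gf ∷ [] , λ m →
    ≈-sym (≈-trans (coeff-++ m (mono 0ᵐ *ₚ f) []) (≈-trans (+-identityʳ _) (*ₚ-identityˡ f m)))


module ToricIdeal {c ℓ} (R : CommutativeRing c ℓ) (d : ℕ) where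

  open import Algebra.Bundles using (CommutativeRing)
  open import Data.Empty using (⊥; ⊥-elim)
  open import Data.Fin.Properties as Fin using ()
  open import Data.Integer.Properties as ℤ using ()
  open import Data.List using (map)
  open import Data.List.Membership.Propositional using (_∈_)
  open import Data.Nat using (ℕ)
  open import Data.Product using (_,_; proj₂)
  open import Data.Sum using (inj₁; inj₂)
  open import Level using (0ℓ)
  open import Relation.Binary using (Rel; Asymmetric)
  open import Relation.Binary.PropositionalEquality using (_≡_; _≢_; refl; sym; trans)
  open import Relation.Nullary using (¬_)
  open import Relation.Unary using (Decidable)

  open Lists
  open IncidenceMatrix

  open CommutativeRing R using (_≈_; 0#) renaming (refl to ≈-refl; sym to ≈-sym; trans to ≈-trans)
  open Poly R (nArcs d)
  open GraphIdeal R d using (BinGen; I_A)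
  open Incidence d
  open Coefficients R (nArcs d)

  binomial∈I_A : ∀ {u v} → u ~A v → I_A (binomial u v)
  binomial∈I_A u~v = generator∈⟨⟩ (_ , _ , u~v , refl)

  fiber? : ∀ m → Decidable (_~A m)
  fiber? m m' = Fin.all? λ w → w ·A m' ℤ.≟ w ·A m

  fiberSum-I_A : ∀ m {f} → I_A f → coeffSum (fiber? m) f ≈ 0#
  fiberSum-I_A m {f} = coeffSum-ideal (fiber? m) BinGen vanishes {f}
    where
    vanishes : ∀ {g} → BinGen g → ∀ h → coeffSum (fiber? m) (h *ₚ g) ≈ 0#
    vanishes (u , v , u~v , refl) = coeffSum-binomial (fiber? m) u v λ b →
      (λ bu~m w → trans (sym (+ᵐ-congˡ-~A b u~v w)) (bu~m w)) , (λ bv~m w → trans (+ᵐ-congˡ-~A b u~v w) (bv~m w))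

  -- Equality in R need not be decidable, so the vanishing of the other coefficients in
  -- the fibre is only available under double negation, which suffices to refute.
  LM-not-fiber-least : ∀ {_≺_ : Rel (Mon (nArcs d)) 0ℓ} → Asymmetric _≺_ → ∀ {f m} → I_A f → LM _≺_ f m →
                       (∀ {m'} → m' ~A m → m' ≢ m → m ≺ m') → ⊥
  LM-not-fiber-least {_≺_} asym {f} {m} f∈I (lead≉0 , below) least =
    ¬¬-∀∈ others-vanish λ vanish →
      lead≉0 (≈-trans (≈-sym (coeffSum-single (fiber? m) f (λ _ → refl) (λ m'∈ → vanish m'∈))) (fiberSum-I_A m {f} f∈I))
    where
    others-vanish : ∀ {m'} → m' ∈ map proj₂ f → ¬ ¬ (m' ~A m → m' ≢ m → coeff m' f ≈ 0#)
    others-vanish {m'} _ ¬vanish = ¬vanish λ m'~m m'≢m → ⊥-elim (¬¬-vanishes m'~m m'≢m λ m'≈0 → ¬vanish λ _ _ → m'≈0)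
      where
      ¬¬-vanishes : m' ~A m → m' ≢ m → ¬ ¬ (coeff m' f ≈ 0#)
      ¬¬-vanishes m'~m m'≢m m'≉0 with below m' m'≉0
      ... | inj₁ m'≡m = m'≢m m'≡m
      ... | inj₂ m'≺m = asym m'≺m (least m'~m m'≢m)


module ShortMonomials {c ℓ} (R : CommutativeRing c ℓ) (d : ℕ) where

  open import Algebra.Bundles using (CommutativeRing)
  open import Data.Empty using (⊥-elim)
  open import Data.Fin using (Fin; toℕ)
  open import Data.Integer as ℤ using (ℤ; +_; 0ℤ; 1ℤ; _-_; _*_)
  open import Data.Integer.Properties as ℤ using ()
  open import Data.List using (allFin)
  open import Data.List.Membership.Propositional using (_∈_)
  open import Data.List.Membership.Propositional.Properties using (∈-allFin)
  open import Data.List.Relation.Unary.Unique.Propositional.Properties using (allFin⁺)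
  open import Data.Nat as ℕ using (ℕ; suc; _<_; _≤_; z≤n)
  open import Data.Nat.Properties as ℕ using (<-cmp)
  open import Data.Product using (_,_)
  open import Data.Sum using (inj₁; inj₂)
  open import Data.Vec using (lookup)
  open import Function using (_∘_)
  open import Relation.Binary using (tri<; tri≈; tri>)
  open import Relation.Binary.PropositionalEquality using (_≡_; _≢_; sym; trans; cong; cong₂; subst; module ≡-Reasoning)

  open Lists
  open GraphArcs
  open Monomials
  open IncidenceMatrix

  open GraphIdeal R d using (_≺lex_)
  open Arcs d
  open Incidence d
  open LexOrder R d

  Short : Mon (nArcs d) → Set
  Short m = ∀ k → 0 < lookup m k → suc (toℕ (src k)) ≡ toℕ (tgt k)

  tail-off-arcs-below-short : ∀ {k k'} → suc (toℕ (src k)) ≡ toℕ (tgt k) → k' ⊏ k → incidenceOf (arc {d}) (src k) k' ≡ 0ℤ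
  tail-off-arcs-below-short {k} {k'} short k'⊏k = cong₂ _-_ (δ-≢ (≢src k'⊏k)) (δ-≢ (≢tgt k'⊏k))
    where
    tgt'≤src' : src k ≡ src k' → toℕ (tgt k') < toℕ (tgt k) → toℕ (tgt k') ≤ toℕ (src k')
    tgt'≤src' same tgt'<tgt = ℕ.≤-pred (subst (toℕ (tgt k') <_) (trans (sym short) (cong (suc ∘ toℕ) same)) tgt'<tgt)
    ≢src : k' ⊏ k → src k ≢ src k'
    ≢src (inj₁ src<src')         same = ℕ.<-irrefl (cong toℕ same) src<src'
    ≢src (inj₂ (same , tgt'<tgt)) _    = ℕ.<⇒≱ (src<tgt k') (tgt'≤src' same tgt'<tgt)
    ≢tgt : k' ⊏ k → src k ≢ tgt k'
    ≢tgt (inj₁ src<src')         same = ℕ.<-asym src<src' (subst (toℕ (src k') <_) (cong toℕ (sym same)) (src<tgt k'))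
    ≢tgt (inj₂ (same , tgt'<tgt)) _    = ℕ.<⇒≱ (src<tgt k') (tgt'≤src' same tgt'<tgt)

  -- Let x_k be the greatest variable where m and m' differ.  If m'_k < m_k, then x_k
  -- occurs in m, so x_k = x_{a,a+1}; among the variables not above x_k only x_k meets
  -- the vertex a, and row a of A (m − m') = 0 forces m_k = m'_k.
  short-lex-least : ∀ {m m'} → Short m → m' ~A m → m' ≢ m → m ≺lex m'
  short-lex-least {m} {m'} short m'~m m'≢m with greatest-difference (m'≢m ∘ sym)
  ... | k , differ , above with <-cmp (lookup m k) (lookup m' k)
  ...   | tri< m<m' _ _ = k , m<m' , λ k' k⊏k' → sym (above k' k⊏k')
  ...   | tri≈ _ same _ = ⊥-elim (differ same)
  ...   | tri> _ _ m'<m = ⊥-elim (differ (ℤ.+-injective (ℤ.i-j≡0⇒i≡j _ _ (sym tail-balance))))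
    where
    open ≡-Reasoning
    variables : List (Fin (nArcs d))
    variables = allFin (nArcs d)
    a : Fin d
    a = src k
    difference : Fin (nArcs d) → ℤ
    difference k' = + lookup m k' - + lookup m' k'
    vanish : ∀ {k'} → k' ∈ variables → k' ≢ k → incidenceOf arc a k' * difference k' ≡ 0ℤ
    vanish {k'} _ k'≢k with ⊏-compare k k'
    ... | tri< k⊏k' _ _ = trans (cong (incidenceOf arc a k' *_) (ℤ.i≡j⇒i-j≡0 (cong +_ (above k' k⊏k')))) (ℤ.*-zeroʳ (incidenceOf arc a k'))
    ... | tri≈ _ k≡k' _ = ⊥-elim (k'≢k (sym k≡k'))
    ... | tri> _ _ k'⊏k = cong (_* difference k') (tail-off-arcs-below-short (short k (ℕ.≤-<-trans z≤n m'<m)) k'⊏k)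
    tail-balance : 0ℤ ≡ difference k
    tail-balance = begin
      0ℤ                                                   ≡⟨ ℤ.i≡j⇒i-j≡0 (sym (m'~m a)) ⟨
      a ·A m - a ·A m'                                     ≡⟨ cong₂ _-_ (·A≡outflow a m) (·A≡outflow a m') ⟩
      outflow arc variables (λ k' → + lookup m k') a - outflow arc variables (λ k' → + lookup m' k') a
                                                           ≡⟨ outflow-- arc variables _ _ a ⟩
      outflow arc variables difference a                   ≡⟨ ℤΣ.Σ-single variables _ (allFin⁺ _) (∈-allFin k) vanish ⟩
      incidenceOf arc a k * difference k                   ≡⟨ cong (_* difference k) (cong₂ _-_ (δ-refl a) (δ-≢ a≢tgt)) ⟩
      1ℤ * difference k                                    ≡⟨ ℤ.*-identityˡ (difference k) ⟩
      difference k                                         ∎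
      where
      a≢tgt : a ≢ tgt k
      a≢tgt same = ℕ.<-irrefl (cong toℕ same) (src<tgt k)


module LowerBoundArgument where

  open import Algebra.Bundles using (CommutativeRing)
  open import Data.Empty using (⊥)
  open import Data.Fin as Fin using (Fin)
  open import Data.Fin.Properties as Fin using ()
  open import Data.Integer as ℤ using (ℤ; +_; -[1+_]; 0ℤ; _-_)
  open import Data.Integer.Properties as ℤ using ()
  open import Data.List as List using (List; allFin; map; filter; length; _++_)
  open import Data.List.Membership.Propositional using (_∈_; _∉_)
  open import Data.List.Membership.Propositional.Properties using (∈-lookup; ∈-allFin; ∈-map⁺; ∈-filter⁺; ∈-filter⁻; ∈-++⁺ˡ; ∈-++⁺ʳ)
  open import Data.List.Properties using (length-++; length-map; length-tabulate)
  open import Data.List.Relation.Unary.All as All using ()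
  open import Data.List.Relation.Unary.Unique.Propositional using (Unique)
  open import Data.List.Relation.Unary.Unique.Propositional.Properties using (filter⁺; allFin⁺)
  open import Data.Nat as ℕ using (ℕ; suc; _<_; _≤_; _∸_; _+_)
  open import Data.Nat.Combinatorics using (_C_)
  open import Data.Nat.Properties as ℕ using ()
  open import Data.Product using (∃-syntax; _×_; _,_; proj₁; proj₂)
  open import Data.Vec as Vec using (lookup)
  open import Data.Vec.Properties using (lookup∘tabulate)
  open import Function using (_∘_)
  open import Level using (0ℓ)
  open import Relation.Binary using (Rel; IsStrictTotalOrder; Tri; tri<; tri≈; tri>)
  open import Relation.Binary.PropositionalEquality using (_≡_; _≢_; refl; sym; trans; cong; cong₂; subst; module ≡-Reasoning)
  open import Relation.Nullary using (¬_; yes; no; Dec)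

  open Lists
  open GraphArcs
  open Monomials
  open IncidenceMatrix
  open Circulations

  _⁺ _⁻ : ℤ → ℕ
  (+ k)      ⁺ = k
  -[1+ _ ]   ⁺ = 0
  (+ _)      ⁻ = 0
  -[1+ k ]   ⁻ = suc k

  ⁺-⁻ : ∀ i → + (i ⁺) - + (i ⁻) ≡ i
  ⁺-⁻ (+ k)      = ℤ.+-identityʳ (+ k)
  ⁺-⁻ -[1+ k ]   = refl

  ⁺≡⁻⇒≡0 : ∀ {i} → i ⁺ ≡ i ⁻ → i ≡ 0ℤ
  ⁺≡⁻⇒≡0 {+ k} k≡0 = cong +_ k≡0

  ⁺>0⇒≢0 : ∀ {i} → 0 < i ⁺ → i ≢ 0ℤ
  ⁺>0⇒≢0 {+ suc _} _ ()

  ⁻>0⇒≢0 : ∀ {i} → 0 < i ⁻ → i ≢ 0ℤ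
  ⁻>0⇒≢0 { -[1+ _ ]} _ ()

  module LowerBound {c ℓ} (K : CommutativeRing c ℓ) (0≉1 : NonTrivial K)
                    (d : ℕ) {_≺_ : Rel (Mon (nArcs d)) 0ℓ} (≺-isTermOrder : IsTermOrder _≺_)
                    {G : List (Poly.Polynomial K (nArcs d))}
                    (G-isReducedGB : Poly.IsReducedGB K (nArcs d) _≺_ (GraphIdeal.I_A K d) G) where

    open Poly K (nArcs d)
    open GraphIdeal K d using (I_A)
    open IsTermOrder ≺-isTermOrder
    open IsStrictTotalOrder isStrictTotalOrder using (compare; asym)
    open IsReducedGB G-isReducedGB
    open Incidence d
    open ToricIdeal K d
    open Coefficients K (nArcs d) using (LM-binomial; LM-unique)
    open import Data.List.Membership.DecPropositional (Fin._≟_ {nArcs d}) using (_∈?_; _∉?_)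

    leading : Fin (length G) → Mon (nArcs d)
    leading p = proj₁ (All.lookup monic (∈-lookup p))

    leading-isLM : ∀ p → LM _≺_ (List.lookup G p) (leading p)
    leading-isLM p = proj₁ (proj₂ (All.lookup monic (∈-lookup p)))

    leading≢0ᵐ : ∀ p → leading p ≢ 0ᵐ
    leading≢0ᵐ p leading≡0 = LM-not-fiber-least asym {List.lookup G p} (All.lookup ⊆I (∈-lookup p))
                               (subst (LM _≺_ (List.lookup G p)) leading≡0 (leading-isLM p))
                               (λ {m'} _ m'≢0 → one-least m' m'≢0)

    chosen : Fin (length G) → Fin (nArcs d)
    chosen p = proj₁ (≢0ᵐ⇒occurs (leading≢0ᵐ p))

    chosenVariables : List (Fin (nArcs d))
    chosenVariables = map chosen (allFin (length G))

    LM-contains-chosen : ∀ {f m} → I_A f → LM _≺_ f m → ∃[ p ] 0 < lookup m (chosen p)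
    LM-contains-chosen {f} {m} f∈I f-LM = divisor-contains-chosen (initial f m f∈I f-LM)
      where
      divisor-contains-chosen : ∃[ p ] ∃[ m' ] (LM _≺_ (List.lookup G p) m' × m' ∣ᵐ m) → ∃[ p ] 0 < lookup m (chosen p)
      divisor-contains-chosen (p , m' , m'-LM , m'∣m) =
        p , ℕ.<-≤-trans (proj₂ (≢0ᵐ⇒occurs (leading≢0ᵐ p)))
                        (subst (λ l → lookup l (chosen p) ≤ lookup m (chosen p))
                               (LM-unique asym {List.lookup G p} m'-LM (leading-isLM p)) (m'∣m (chosen p)))

    unchosen : List (Fin (nArcs d))
    unchosen = filter (_∉? chosenVariables) (allFin (nArcs d))

    unchosen-unique : Unique unchosen
    unchosen-unique = filter⁺ (_∉? chosenVariables) (allFin⁺ (nArcs d))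

    nArcs≤unchosen+length : nArcs d ≤ length unchosen + length G
    nArcs≤unchosen+length = begin
      nArcs d                                         ≡⟨ length-tabulate (λ k → k) ⟨
      length (allFin (nArcs d))                       ≤⟨ unique-⊆⇒length≤ (allFin⁺ (nArcs d)) covered ⟩
      length (unchosen ++ chosenVariables)            ≡⟨ length-++ unchosen ⟩
      length unchosen + length chosenVariables
        ≡⟨ cong (λ t → length unchosen + t) (trans (length-map chosen (allFin (length G))) (length-tabulate (λ p → p))) ⟩
      length unchosen + length G                      ∎
      where
      open ℕ.≤-Reasoning
      covered : ∀ {k} → k ∈ allFin (nArcs d) → k ∈ unchosen ++ chosenVariables
      covered {k} k∈ = by-cases (k ∈? chosenVariables)
        where
        by-cases : Dec (k ∈ chosenVariables) → k ∈ unchosen ++ chosenVariables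
        by-cases (yes k∈C) = ∈-++⁺ʳ unchosen k∈C
        by-cases (no  k∉C) = ∈-++⁺ˡ (∈-filter⁺ (_∉? chosenVariables) k∈ k∉C)

    no-circulation-on-unchosen : ¬ NontrivialCirculation (arc {d}) unchosen
    no-circulation-on-unchosen C = by-compare (compare u v)
      where
      open NontrivialCirculation C
      u v : Mon (nArcs d)
      u = Vec.tabulate (λ k → weight k ⁺)
      v = Vec.tabulate (λ k → weight k ⁻)

      u≢v : u ≢ v
      u≢v u≡v = proj₂ weight-nonzero
        (⁺≡⁻⇒≡0 (trans (sym (lookup∘tabulate _ x)) (trans (cong (λ l → lookup l x) u≡v) (lookup∘tabulate _ x))))
        where
        x : Fin (nArcs d)
        x = proj₁ weight-nonzero

      u~v : u ~A v
      u~v w = ℤ.i-j≡0⇒i≡j _ _ (begin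
        w ·A u - w ·A v                                     ≡⟨ cong₂ _-_ (·A≡outflow w u) (·A≡outflow w v) ⟩
        outflow arc variables (λ k → + lookup u k) w - outflow arc variables (λ k → + lookup v k) w
                                                            ≡⟨ outflow-- arc variables _ _ w ⟩
        outflow arc variables (λ k → + lookup u k - + lookup v k) w
                                                            ≡⟨ outflow-cong arc variables (λ {k} _ → parts k) w ⟩
        outflow arc variables weight w                      ≡⟨ outflow-filter arc (_∉? chosenVariables) variables weight-chosen w ⟩
        outflow arc unchosen weight w                       ≡⟨ balanced w ⟩
        0ℤ                                                  ∎)
        where
        open ≡-Reasoning
        variables : List (Fin (nArcs d))
        variables = allFin (nArcs d)
        parts : ∀ k → + lookup u k - + lookup v k ≡ weight k
        parts k = trans (cong₂ (λ a b → + a - + b) (lookup∘tabulate _ k) (lookup∘tabulate _ k)) (⁺-⁻ (weight k))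
        weight-chosen : ∀ {k} → ¬ k ∉ chosenVariables → weight k ≡ 0ℤ
        weight-chosen k∈C = weight-outside (k∈C ∘ proj₂ ∘ ∈-filter⁻ (_∉? chosenVariables) {xs = allFin (nArcs d)})

      weighted-unchosen : ∀ {k} → weight k ≢ 0ℤ → k ∉ chosenVariables
      weighted-unchosen w≢0 k∈C = w≢0 (weight-outside λ k∈U → proj₂ (∈-filter⁻ (_∉? chosenVariables) {xs = allFin (nArcs d)} k∈U) k∈C)

      leading-term-misses : ∀ {x y} → y ≺ x → x ≢ y → x ~A y → (∀ k → 0 < lookup x k → weight k ≢ 0ℤ) → ⊥
      leading-term-misses {x} {y} y≺x x≢y x~y support =
        let p , occurs = LM-contains-chosen {binomial x y} (binomial∈I_A x~y) (LM-binomial {_≺_ = _≺_} 0≉1 y≺x x≢y)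
        in weighted-unchosen (support (chosen p) occurs) (∈-map⁺ chosen (∈-allFin p))

      by-compare : Tri (u ≺ v) (u ≡ v) (v ≺ u) → ⊥
      by-compare (tri< u≺v _ _) = leading-term-misses u≺v (u≢v ∘ sym) (sym ∘ u~v)
                                    (λ k occurs → ⁻>0⇒≢0 (subst (0 <_) (lookup∘tabulate _ k) occurs))
      by-compare (tri≈ _ u≡v _) = u≢v u≡v
      by-compare (tri> _ _ v≺u) = leading-term-misses v≺u u≢v u~v
                                    (λ k occurs → ⁺>0⇒≢0 (subst (0 <_) (lookup∘tabulate _ k) occurs))

  lowerBound : ∀ {c ℓ} (K : CommutativeRing c ℓ) → NonTrivial K →
               ∀ d (_≺_ : Rel (Mon (nArcs (suc d))) 0ℓ) (G : List (Poly.Polynomial K (nArcs (suc d)))) → IsTermOrder _≺_ →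
               Poly.IsReducedGB K (nArcs (suc d)) _≺_ (GraphIdeal.I_A K (suc d)) G → suc d C 2 ∸ d ≤ length G
  lowerBound K 0≉1 d _≺_ G ≺-isTermOrder G-isReducedGB =
    ℕ.m≤n+o⇒m∸n≤o _ d (ℕ.≤-trans (subst (_≤ length unchosen + length G) (nArcs≡C2 (suc d)) nArcs≤unchosen+length)
                                 (ℕ.+-monoˡ-≤ (length G) unchosen≤d))
    where
    open LowerBound K 0≉1 (suc d) ≺-isTermOrder G-isReducedGB
    unchosen≤d : length unchosen ≤ d
    unchosen≤d = ℕ.≮⇒≥ λ d<unchosen →
      no-circulation-on-unchosen (nontrivialCirculation Fin._≟_ (arc {suc d}) unchosen unchosen-unique d<unchosen)


module PathGroebnerBasis where

  open import Algebra.Bundles using (CommutativeRing)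
  open import Data.Empty using (⊥-elim)
  open import Data.Fin as Fin using (Fin; toℕ)
  open import Data.Fin.Properties as Fin using ()
  open import Data.List as List using (List; length)
  open import Data.List.Membership.Propositional using (_∈_)
  open import Data.List.Membership.Propositional.Properties using (∈-lookup; ∈-map⁺; ∈-filter⁺; ∈-filter⁻)
  open import Data.List.Properties using (length-map)
  open import Data.List.Relation.Unary.All as All using (All)
  open import Data.List.Relation.Unary.All.Properties as All using ()
  open import Data.List.Relation.Unary.Any as Any using ()
  open import Data.List.Relation.Unary.Any.Properties using (lookup-index)
  open import Data.List.Relation.Unary.Unique.Propositional using (Unique)
  open import Data.List.Relation.Unary.Unique.Propositional.Properties using (filter⁺)
  open import Data.Nat as ℕ using (ℕ; suc; _<_; _≤_; _∸_; z≤n; s≤s)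
  open import Data.Nat.Combinatorics using (_C_)
  open import Data.Nat.Properties as ℕ using ()
  open import Data.Product using (∃-syntax; _×_; _,_; proj₁; proj₂)
  open import Data.Sum using (_⊎_; inj₁; inj₂)
  open import Data.Vec using (lookup)
  open import Function using (_∘_)
  open import Relation.Binary using (IsStrictTotalOrder; Asymmetric)
  open import Relation.Binary.PropositionalEquality using (_≡_; _≢_; refl; sym; trans; cong; subst; subst₂)
  open import Relation.Nullary using (¬_; yes; no; Dec; _×-dec_)

  open Lists
  open GraphArcs
  open Monomials
  open IncidenceMatrix

  module PathBasis {c ℓ} (K : CommutativeRing c ℓ) (0≉1 : NonTrivial K) (d : ℕ) where

    open CommutativeRing K using (_≈_; 0#; 1#)
    open Poly K (nArcs d)
    open GraphIdeal K d using (I_A; _≺lex_; _≻var_; varMon; pathMon; pathGB)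
    open Arcs d
    open Incidence d
    open LexOrder K d
    open PathMonomials K d
    open ShortMonomials K d
    open ToricIdeal K d
    open Coefficients K (nArcs d) using (LM-binomial; LM-unique; coeff-binomial-lead; binomial-support)

    ≺lex-asym : Asymmetric _≺lex_
    ≺lex-asym {u} {v} = IsStrictTotalOrder.asym ≺lex-isStrictTotalOrder {u} {v}

    generator : Arc d → Polynomial
    generator ij = binomial (varMon ij) (pathMon ij)

    module _ {i j : Fin d} (long : suc (toℕ i) < toℕ j) where

      longVar : Fin (nArcs d)
      longVar = proj₁ (arc-surjective (ℕ.<-trans (ℕ.n<1+n _) long))

      arc-longVar : arc {d} longVar ≡ (i , j)
      arc-longVar = proj₂ (arc-surjective (ℕ.<-trans (ℕ.n<1+n _) long))

      long-off-paths : ∀ ij' → lookup (pathMon ij') longVar ≡ 0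
      long-off-paths ij' = pathMon-off longVar λ (short , _) →
        ℕ.<-irrefl (trans (cong (suc ∘ toℕ ∘ proj₁) (sym arc-longVar)) (trans short (cong (toℕ ∘ proj₂) arc-longVar))) long

      varMon≢pathMon : varMon (i , j) ≢ pathMon (i , j)
      varMon≢pathMon same =
        ℕ.1+n≢0 (trans (sym (varMon-at longVar arc-longVar)) (trans (cong (λ m → lookup m longVar) same) (long-off-paths (i , j))))

      pathMon≺varMon : pathMon (i , j) ≺lex varMon (i , j)
      pathMon≺varMon = longVar , subst₂ _<_ (sym (long-off-paths (i , j))) (sym (varMon-at longVar arc-longVar)) (s≤s z≤n) , above
        where
        above : ∀ k' → longVar ⊏ k' → lookup (varMon (i , j)) k' ≡ lookup (pathMon (i , j)) k'
        above k' longVar⊏k' =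
          trans (varMon-off k' λ arc≡ij → ⊏-irrefl (arc-injective (trans arc-longVar (sym arc≡ij))) longVar⊏k')
                (sym (pathMon-off k' (off-path (subst (arc {d} k' ≻var_) arc-longVar longVar⊏k'))))
          where
          off-path : arc {d} k' ≻var (i , j) → ¬ OnPath (i , j) (arc {d} k')
          off-path (inj₁ src<i)        (_ , i≤src , _) = ℕ.<⇒≱ src<i i≤src
          off-path (inj₂ (_ , j<tgt))  (_ , _ , tgt≤j) = ℕ.<⇒≱ j<tgt tgt≤j

      generator-LM : LM _≺lex_ (generator (i , j)) (varMon (i , j))
      generator-LM = LM-binomial {_≺_ = _≺lex_} 0≉1 pathMon≺varMon varMon≢pathMon

      generator-monic : coeff (varMon (i , j)) (generator (i , j)) ≈ 1#
      generator-monic = coeff-binomial-lead varMon≢pathMon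

      generator∈I_A : I_A (generator (i , j))
      generator∈I_A = binomial∈I_A (varMon~pathMon (ℕ.<-trans (ℕ.n<1+n _) long))

    ∈-longArcs⁻ : ∀ {ij} → ij ∈ longArcs → suc (toℕ (proj₁ ij)) < toℕ (proj₂ ij)
    ∈-longArcs⁻ = proj₂ ∘ ∈-filter⁻ long? {xs = arcs d}

    longArcs-unique : Unique longArcs
    longArcs-unique = filter⁺ long? arcs-unique

    pathGB-⊆I_A : All I_A pathGB
    pathGB-⊆I_A = All.map⁺ (All.tabulate (generator∈I_A ∘ ∈-longArcs⁻))

    pathGB-monic : All (λ g → ∃[ m ] (LM _≺lex_ g m × coeff m g ≈ 1#)) pathGB
    pathGB-monic = All.map⁺ (All.tabulate λ {ij} ij∈ → varMon ij , generator-LM (∈-longArcs⁻ ij∈) , generator-monic (∈-longArcs⁻ ij∈))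

    generator-at : ∀ p → List.lookup pathGB p ≡ generator (List.lookup longArcs (Fin.cast (length-map generator longArcs) p))
    generator-at = lookup-map generator longArcs

    pathGB-initial : ∀ f m → I_A f → LM _≺lex_ f m → ∃[ p ] ∃[ m' ] (LM _≺lex_ (List.lookup pathGB p) m' × m' ∣ᵐ m)
    pathGB-initial f m f∈I f-LM = by-cases (Fin.any? λ k → (0 ℕ.<? lookup m k) ×-dec long? (arc {d} k))
      where
      by-cases : Dec (∃[ k ] (0 < lookup m k × suc (toℕ (src k)) < toℕ (tgt k))) →
                 ∃[ p ] ∃[ m' ] (LM _≺lex_ (List.lookup pathGB p) m' × m' ∣ᵐ m)
      by-cases (yes (k , occurs , long)) =
        p , varMon (arc {d} k) , subst (λ g → LM _≺lex_ g (varMon (arc {d} k))) generator≡ (generator-LM long) , divides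
        where
        generator∈ : generator (arc {d} k) ∈ pathGB
        generator∈ = ∈-map⁺ generator (∈-filter⁺ long? {xs = arcs d} (∈-lookup k) long)
        p : Fin (length pathGB)
        p = Any.index generator∈
        generator≡ : generator (arc {d} k) ≡ List.lookup pathGB p
        generator≡ = lookup-index generator∈
        divides : varMon (arc {d} k) ∣ᵐ m
        divides k' = by-variable (k' Fin.≟ k)
          where
          by-variable : Dec (k' ≡ k) → lookup (varMon (arc {d} k)) k' ≤ lookup m k'
          by-variable (yes refl) = subst (_≤ lookup m k) (sym (varMon-at k refl)) occurs
          by-variable (no  k'≢k) = subst (_≤ lookup m k') (sym (varMon-off k' (k'≢k ∘ arc-injective))) z≤n
      by-cases (no none) =
        ⊥-elim (LM-not-fiber-least {_≺_ = _≺lex_} (λ {u v} → ≺lex-asym {u} {v}) {f} f∈I f-LM (λ {m'} → short-lex-least {m} {m'} short))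
        where
        short : Short m
        short k occurs = ℕ.≤-antisym (src<tgt k) (ℕ.≮⇒≥ λ long → none (k , occurs , long))

    pathGB-reduced : ∀ p p' → p ≢ p' → ∀ m → LM _≺lex_ (List.lookup pathGB p) m →
                     ∀ m' → ¬ coeff m' (List.lookup pathGB p') ≈ 0# → ¬ m ∣ᵐ m'
    pathGB-reduced p p' p≢p' m m-LM m' m'-support m∣m' =
      ℕ.1+n≰n (subst₂ _≤_ m-at-k₀ m'-at-k₀ (m∣m' k₀))
      where
      ij ij' : Arc d
      ij = List.lookup longArcs (Fin.cast (length-map generator longArcs) p)
      ij' = List.lookup longArcs (Fin.cast (length-map generator longArcs) p')
      long : suc (toℕ (proj₁ ij)) < toℕ (proj₂ ij)
      long = ∈-longArcs⁻ (∈-lookup _)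
      k₀ : Fin (nArcs d)
      k₀ = longVar long
      arc≡ij : arc {d} k₀ ≡ ij
      arc≡ij = arc-longVar long
      m≡varMon : m ≡ varMon ij
      m≡varMon = LM-unique {_≺_ = _≺lex_} (λ {u v} → ≺lex-asym {u} {v}) {generator ij} {m} {varMon ij}
                           (subst (λ g → LM _≺lex_ g m) (generator-at p) m-LM) (generator-LM long)
      m-at-k₀ : lookup m k₀ ≡ 1
      m-at-k₀ = trans (cong (λ l → lookup l k₀) m≡varMon) (varMon-at k₀ arc≡ij)
      m'-at-k₀ : lookup m' k₀ ≡ 0
      m'-at-k₀ = by-support (binomial-support {m'} {varMon ij'} {pathMon ij'}
                                              (subst (λ g → ¬ coeff m' g ≈ 0#) (generator-at p') m'-support))
        where
        by-support : m' ≡ varMon ij' ⊎ m' ≡ pathMon ij' → lookup m' k₀ ≡ 0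
        by-support (inj₁ refl) = varMon-off k₀ λ arc≡ij' →
          p≢p' (cast-injective _ (lookup-injective longArcs-unique (trans (sym arc≡ij) arc≡ij')))
        by-support (inj₂ refl) = long-off-paths long ij'

    pathGB-isReducedGB : IsReducedGB _≺lex_ I_A pathGB
    pathGB-isReducedGB = record
      { ⊆I      = pathGB-⊆I_A
      ; monic   = pathGB-monic
      ; initial = pathGB-initial
      ; reduced = pathGB-reduced
      }

  length-pathGB : ∀ {c ℓ} (K : CommutativeRing c ℓ) d → length (GraphIdeal.pathGB K d) ≡ d C 2 ∸ (d ∸ 1)
  length-pathGB K d = trans (length-map _ (Arcs.longArcs d)) (length-longArcs d)


open Monomials using (module LexOrder)
open LowerBoundArgument using (lowerBound)
open PathGroebnerBasis using (module PathBasis; length-pathGB)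

proposition4p11 : ∀ {c ℓ} (K : CommutativeRing c ℓ) → IsField K → (d : ℕ) → 1 ≤ d →
    let open Poly K (nArcs d) in
    let open GraphIdeal K d in
      (∀ (_≺_ : Rel (Mon (nArcs d)) _) (G : List Polynomial) → IsTermOrder _≺_ →
         IsReducedGB _≺_ I_A G → (d C 2) ∸ (d ∸ 1) ≤ length G)
      × IsTermOrder _≺lex_
      × IsReducedGB _≺lex_ I_A pathGB
      × length pathGB ≡ (d C 2) ∸ (d ∸ 1)
proposition4p11 K K-field (suc d) _ =
  lowerBound K 0≉1 d , LexOrder.≺lex-isTermOrder K (suc d) , PathBasis.pathGB-isReducedGB K 0≉1 (suc d) , length-pathGB K (suc d)
  where open IsField K-field using (0≉1)
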